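{- Let $\lambda$ be a strict partition with $n$ parts. Then \[ g^\lambda=\frac{|\lambda|!}{\prod_{j=1}^n(\lambda_j-1)!}\int_{0\le x_1\le\cdots\le x_n\le 1}\overline{a}_{\lambda-(1^n)}(x)\,dx. \]
   Context: For a strict partition $\lambda=(\lambda_1>\dots>\lambda_n>0)$, $g^\lambda$ is the number of standard Young tableaux of shifted shape $\lambda$, i.e., fillings of the shifted diagram $\{(i,j):1\le i\le n,\ i\le j\le\lambda_i+i-1\}$ with $1,\dots,|\lambda|$, each used once, increasing along rows and columns. For a sequence $\mu=(\mu_1,\dots,\mu_n)$ of nonnegative integers and variables $x=(x_1,\dots,x_n)$, $a_\mu(x)=\det(x_j^{\mu_i})_{i,j=1}^n$ and $\overline{a}_\mu(x)=(-1)^{\binom n2}a_\mu(x)$. Here $\lambda-(1^n)=(\lambda_1-1,\dots,\lambda_n-1)$, and the integral is over the region $0\le x_1\le x_2\le\dots\le x_n\le1$. -}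

module Defs where

open import Data.Nat as ℕ using (ℕ; zero; suc; _≤_; _<_; _∸_; NonZero)
open import Data.Nat.Base using (_!)
open import Data.Nat.Properties using (m*n≢0; _!≢0)
open import Data.Integer using (+_)
open import Data.Rational using (ℚ; _/_; 0ℚ; 1ℚ; -_) renaming (_+_ to _+ℚ_; _*_ to _*ℚ_)
open import Data.Fin using (Fin; zero; suc; punchIn; _≟_)
open import Data.Fin as F using ()
open import Data.Vec as V using (Vec; []; _∷_)
open import Data.List as L using (List; []; _∷_; _++_; length; upTo; allFin; concatMap)
open import Data.Product using (_×_; _,_; Σ-syntax)
open import Data.Bool using (if_then_else_)
open import Relation.Nullary.Decidable using (⌊_⌋)
open import Relation.Binary.PropositionalEquality using (_≡_)
open import Function.Bundles using (_⇔_)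
open import Data.List.Membership.Propositional using (_∈_)
open import Data.List.Relation.Unary.Unique.Propositional using (Unique)

StrictPartition : ∀ {n} → Vec ℕ n → Set
StrictPartition {n} lam =
  ((i : Fin n) → 0 < V.lookup lam i) ×
  ((i j : Fin n) → i F.< j → V.lookup lam j < V.lookup lam i)

size : ∀ {n} → Vec ℕ n → ℕ
size = V.sum

-- Shifted diagram, 0-indexed: row i (0 ≤ i < n) contains the cells
-- (i , i + k) for 0 ≤ k < λ_i.

cellsFrom : ∀ {n} → ℕ → Vec ℕ n → List (ℕ × ℕ)
cellsFrom i []         = []
cellsFrom i (l ∷ lam)  = L.map (λ k → (i , i ℕ.+ k)) (upTo l) ++ cellsFrom (suc i) lam

cells : ∀ {n} → Vec ℕ n → List (ℕ × ℕ)
cells = cellsFrom 0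

Cell : ∀ {n} → Vec ℕ n → Set
Cell lam = Fin (length (cells lam))

row col : ∀ {n} {lam : Vec ℕ n} → Cell lam → ℕ
row {lam = lam} p with L.lookup (cells lam) p
... | (i , j) = i
col {lam = lam} p with L.lookup (cells lam) p
... | (i , j) = j

Filling : ∀ {n} → Vec ℕ n → Set
Filling lam = Vec ℕ (length (cells lam))

-- Standard Young tableau of shifted shape λ: entries 1..|λ| each used
-- once (injective with values in [1,|λ|], #cells = |λ|), strictly
-- increasing along rows and down columns.
IsSYT : ∀ {n} (lam : Vec ℕ n) → Filling lam → Set
IsSYT lam t =
  ((p : Cell lam) → 1 ≤ V.lookup t p × V.lookup t p ≤ size lam) ×
  ((p q : Cell lam) → V.lookup t p ≡ V.lookup t q → p ≡ q) ×
  ((p q : Cell lam) → row {lam = lam} p ≡ row {lam = lam} q →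
      col {lam = lam} p < col {lam = lam} q → V.lookup t p < V.lookup t q) ×
  ((p q : Cell lam) → col {lam = lam} p ≡ col {lam = lam} q →
      row {lam = lam} p < row {lam = lam} q → V.lookup t p < V.lookup t q)

-- "The number of standard Young tableaux of shifted shape λ is (the
-- rational) r": there is a duplicate-free list enumerating exactly the
-- SYT of shape λ whose length equals r.
NumSYTEquals : ∀ {n} (lam : Vec ℕ n) → ℚ → Set
NumSYTEquals lam r =
  Σ[ Ls ∈ List (Filling lam) ]
    (Unique Ls × ((t : Filling lam) → (t ∈ Ls ⇔ IsSYT lam t)) ×
     ((+ length Ls) / 1 ≡ r))

-- Polynomials in n variables x_0..x_{n-1} with rational coefficients,
-- as finite formal sums of terms (coefficient , exponent vector).

Poly : ℕ → Set
Poly n = List (ℚ × Vec ℕ n)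

constP : ∀ {n} → ℚ → Poly n
constP c = (c , V.replicate _ 0) ∷ []

varPow : ∀ {n} → Fin n → ℕ → Poly n
varPow j k = (1ℚ , V.tabulate (λ i → if ⌊ i ≟ j ⌋ then k else 0)) ∷ []

_+P_ : ∀ {n} → Poly n → Poly n → Poly n
_+P_ = _++_

_*P_ : ∀ {n} → Poly n → Poly n → Poly n
p *P q = concatMap (λ { (c , a) → L.map (λ { (d , b) → (c *ℚ d , V.zipWith ℕ._+_ a b) }) q }) p

negP : ∀ {n} → Poly n → Poly n
negP = L.map (λ { (c , a) → (- c , a) })

signP : ∀ {n} → ℕ → Poly n → Poly n
signP zero    p = p
signP (suc k) p = negP (signP k p)

sumFin : ∀ {m} k → (Fin k → Poly m) → Poly m
sumFin k f = L.foldr _+P_ [] (L.map f (allFin k))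

det : ∀ {m} k → (Fin k → Fin k → Poly m) → Poly m
det zero    M = constP 1ℚ
det (suc k) M = sumFin (suc k) λ j →
  signP (F.toℕ j) (M zero j *P det k (λ i l → M (suc i) (punchIn j l)))

aPoly : ∀ {n} → Vec ℕ n → Poly n
aPoly {n} mu = det n (λ i j → varPow j (V.lookup mu i))

abarPoly : ∀ {n} → Vec ℕ n → Poly n
abarPoly {n} mu = signP ((n ℕ.* (n ∸ 1)) ℕ./ 2) (aPoly mu)

-- Integral over 0 ≤ x_0 ≤ x_1 ≤ … ≤ x_{n-1} ≤ 1, computed by iterated
-- integration:  ∫_0^{x_1} x_0^a dx_0 = x_1^(a+1)/(a+1), …,
-- ∫_0^1 x^a dx = 1/(a+1).

intMonomial : ∀ n → Vec ℕ n → ℚ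
intMonomial zero          []                = 1ℚ
intMonomial (suc zero)    (a ∷ [])          = (+ 1) / suc a
intMonomial (suc (suc m)) (a ∷ b ∷ rest)    =
  ((+ 1) / suc a) *ℚ intMonomial (suc m) ((suc a ℕ.+ b) ∷ rest)

integralSimplex : ∀ {n} → Poly n → ℚ
integralSimplex {n} p = L.foldr _+ℚ_ 0ℚ (L.map (λ { (c , a) → c *ℚ intMonomial n a }) p)

factProd : ∀ {n} → Vec ℕ n → ℕ
factProd []       = 1
factProd (a ∷ mu) = a ! ℕ.* factProd mu

factProd≢0 : ∀ {n} (mu : Vec ℕ n) → NonZero (factProd mu)
factProd≢0 []       = _
factProd≢0 (a ∷ mu) = m*n≢0 (a !) (factProd mu) {{a !≢0}} {{factProd≢0 mu}}

minusOnes : ∀ {n} → Vec ℕ n → Vec ℕ n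
minusOnes = V.map (_∸ 1)

rhs : ∀ {n} → Vec ℕ n → ℚ
rhs lam =
  ((+ (size lam !)) / factProd (minusOnes lam)) {{factProd≢0 (minusOnes lam)}}
  *ℚ integralSimplex (abarPoly (minusOnes lam))

{-# OPTIONS --safe #-}
module Submission where

-- Both sides satisfy the same recursion over the removable corners of the shifted diagram.
-- In a standard tableau the largest entry sits in a corner, and deleting it leaves a standard
-- tableau of the smaller shape. On the other side, write the integral as an alternant in the
-- exponents e = λ − 1. Applying ∑_w ∂/∂x_w and the divergence theorem on the simplex gives
--   (|e| + n) ∫ a_e = ∑_i e_i ∫ a_{e − δ_i} + (the integral over the face x_0 = 0);
-- the i-th term vanishes unless row i can shrink (else two rows of the determinant coincide),
-- and the face term is the integral for λ with a last row of length 1 removed.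

open import Defs
open import Data.Empty using (⊥-elim)
open import Data.Fin using (zero)
open import Data.List using ([]; _∷_)
open import Data.List.Membership.Propositional using (_∈_)
open import Data.List.Relation.Unary.Any using (here)
import Data.List.Relation.Unary.All as All
import Data.List.Relation.Unary.AllPairs as AllPairs
open import Data.Nat using (ℕ; zero; suc)
import Data.Nat.Properties as ℕₚ
open import Data.Product using (_,_)
open import Data.Vec using (Vec; []; _∷_)
open import Function.Bundles using (mk⇔)
open import Relation.Binary.PropositionalEquality using (_≡_; refl; sym)

module Alternants where

  open import Defs
  open import Algebra.Bundles using (CommutativeRing)
  open import Data.Fin as Fin using (Fin; zero; suc; punchIn; punchOut; toℕ)
  import Data.Fin.Properties as Finₚ
  open import Data.Integer as ℤ using (ℤ) renaming (+_ to +ℤ_)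
  import Data.Integer.Properties as ℤₚ
  open import Data.List as List using ([]; _∷_)
  import Data.List.Properties as Listₚ
  open import Data.Nat as ℕ using (ℕ; zero; suc; NonZero; _≤_)
  open import Data.Nat.Tactic.RingSolver using (solve-∀)
  import Data.Nat.Properties as ℕₚ
  open import Data.Product using (_,_)
  open import Data.Rational using (ℚ; 0ℚ; 1ℚ; _+_; _*_; -_; _/_; toℚᵘ)
  import Data.Rational.Properties as ℚₚ
  open import Data.Rational.Solver as ℚ-Solver using ()
  open import Data.Rational.Unnormalised using (mkℚᵘ; *≡*) renaming (_≃_ to _≃ᵘ_)
  import Data.Rational.Unnormalised.Properties as ℚᵘₚ
  open import Data.Vec as Vec using (Vec; []; _∷_; _[_]%=_)
  import Data.Vec.Properties as Vecₚ
  open import Data.Vec.Functional using (updateAt)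
  open import Data.Bool using (if_then_else_)
  open import Data.Empty using (⊥-elim)
  open import Function using (_∘_; id)
  open import Function.Definitions using (Injective)
  open import Relation.Binary.PropositionalEquality using (_≡_; _≢_; refl; sym; trans; cong; cong₂; module ≡-Reasoning)
  open import Relation.Nullary using (yes; no)
  open import Relation.Nullary.Decidable using (⌊_⌋)

  open import Algebra.Properties.Semiring.Sum (CommutativeRing.semiring ℚₚ.+-*-commutativeRing)
    public using (sum; sum-syntax; sum-cong-≗; sum-replicate-zero; sum-remove; ∑-distrib-+; ∑-comm; *-distribˡ-sum)

  open import Algebra.Properties.CommutativeSemigroup ℕₚ.+-commutativeSemigroup using ()
    renaming (x∙yz≈y∙xz to ℕ-+-leftComm; interchange to ℕ-+-interchange)

  open ≡-Reasoning
  open ℚ-Solver.+-*-Solver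

  ι : ℕ → ℚ
  ι n = +ℤ n / 1

  toℚᵘ-/ : ∀ (i : ℤ) c .{{_ : NonZero c}} → toℚᵘ (i / c) ≃ᵘ mkℚᵘ i (ℕ.pred c)
  toℚᵘ-/ i (suc c) = ℚₚ.toℚᵘ-fromℚᵘ (mkℚᵘ i c)

  fraction-≡ : ∀ (i j : ℤ) c d .{{_ : NonZero c}} .{{_ : NonZero d}} →
               i ℤ.* +ℤ d ≡ j ℤ.* +ℤ c → i / c ≡ j / d
  fraction-≡ i j (suc c) (suc d) eq = ℚₚ.fromℚᵘ-cong {mkℚᵘ i c} {mkℚᵘ j d} (*≡* eq)

  fraction-* : ∀ (i j : ℤ) c d .{{_ : NonZero c}} .{{_ : NonZero d}} →
               (i / c) * (j / d) ≡ ((i ℤ.* j) / (c ℕ.* d)) {{ℕₚ.m*n≢0 c d}}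
  fraction-* i j c@(suc _) d@(suc _) = ℚₚ.toℚᵘ-injective (ℚᵘₚ.≃-trans
    (ℚₚ.toℚᵘ-homo-* (i / c) (j / d))
    (ℚᵘₚ.≃-trans (ℚᵘₚ.*-cong (toℚᵘ-/ i c) (toℚᵘ-/ j d)) (ℚᵘₚ.≃-sym (toℚᵘ-/ (i ℤ.* j) (c ℕ.* d)))))

  ι-+ : ∀ m n → ι (m ℕ.+ n) ≡ ι m + ι n
  ι-+ m n = ℚₚ.toℚᵘ-injective (ℚᵘₚ.≃-trans (toℚᵘ-/ (+ℤ (m ℕ.+ n)) 1) (ℚᵘₚ.≃-trans (*≡* eq)
    (ℚᵘₚ.≃-sym (ℚᵘₚ.≃-trans (ℚₚ.toℚᵘ-homo-+ (ι m) (ι n))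
      (ℚᵘₚ.+-cong (toℚᵘ-/ (+ℤ m) 1) (toℚᵘ-/ (+ℤ n) 1))))))
    where
    eq : +ℤ (m ℕ.+ n) ℤ.* +ℤ 1 ≡ (+ℤ m ℤ.* +ℤ 1 ℤ.+ +ℤ n ℤ.* +ℤ 1) ℤ.* +ℤ 1
    eq = cong (ℤ._* +ℤ 1) (trans (ℤₚ.pos-+ m n)
           (sym (cong₂ ℤ._+_ (ℤₚ.*-identityʳ (+ℤ m)) (ℤₚ.*-identityʳ (+ℤ n)))))

  1/suc-*-ι : ∀ a → (+ℤ 1 / suc a) * ι (suc a) ≡ 1ℚ
  1/suc-*-ι a = trans (fraction-* (+ℤ 1) (+ℤ (suc a)) (suc a) 1)
    (fraction-≡ (+ℤ 1 ℤ.* +ℤ suc a) (+ℤ 1) (suc a ℕ.* 1) 1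
      (trans (ℤₚ.*-identityʳ _) (cong (λ x → +ℤ 1 ℤ.* +ℤ x) (sym (ℕₚ.*-identityʳ (suc a))))))

  /-cancel : ∀ a b c d .{{_ : NonZero c}} .{{_ : NonZero d}} → a ℕ.* d ≡ b ℕ.* c → +ℤ a / c ≡ +ℤ b / d
  /-cancel a b c d eq = fraction-≡ (+ℤ a) (+ℤ b) c d (trans (sym (ℤₚ.pos-* a d)) (trans (cong +ℤ_ eq) (ℤₚ.pos-* b c)))

  ι-*-/ : ∀ a b c .{{_ : NonZero c}} → ι a * (+ℤ b / c) ≡ +ℤ (a ℕ.* b) / c
  ι-*-/ a b c = trans (fraction-* (+ℤ a) (+ℤ b) 1 c)
    (fraction-≡ (+ℤ a ℤ.* +ℤ b) (+ℤ (a ℕ.* b)) (1 ℕ.* c) c {{ℕₚ.m*n≢0 1 c}}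
      (cong₂ ℤ._*_ (sym (ℤₚ.pos-* a b)) (cong +ℤ_ (sym (ℕₚ.*-identityˡ c)))))

  infixr 8 -1^_·_

  -1^_·_ : ℕ → ℚ → ℚ
  -1^ zero  · x = x
  -1^ suc k · x = - (-1^ k · x)

  -1^-distrib-+ : ∀ k x y → -1^ k · (x + y) ≡ -1^ k · x + -1^ k · y
  -1^-distrib-+ zero    x y = refl
  -1^-distrib-+ (suc k) x y = trans (cong -_ (-1^-distrib-+ k x y)) (ℚₚ.neg-distrib-+ (-1^ k · x) (-1^ k · y))

  -1^-*-comm : ∀ k c x → -1^ k · (c * x) ≡ c * -1^ k · x
  -1^-*-comm zero    c x = refl
  -1^-*-comm (suc k) c x = trans (cong -_ (-1^-*-comm k c x)) (ℚₚ.neg-distribʳ-* c _)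

  -1^-zero : ∀ k → -1^ k · 0ℚ ≡ 0ℚ
  -1^-zero zero    = refl
  -1^-zero (suc k) = cong -_ (-1^-zero k)

  -1^-+ : ∀ a b x → -1^ (a ℕ.+ b) · x ≡ -1^ a · -1^ b · x
  -1^-+ zero    b x = refl
  -1^-+ (suc a) b x = cong -_ (-1^-+ a b x)

  -1^-neg : ∀ k x → -1^ k · (- x) ≡ - -1^ k · x
  -1^-neg zero    x = refl
  -1^-neg (suc k) x = cong -_ (-1^-neg k x)

  -1^-involutive : ∀ k x → -1^ k · -1^ k · x ≡ x
  -1^-involutive zero    x = refl
  -1^-involutive (suc k) x = begin
    - -1^ k · (- -1^ k · x) ≡⟨ cong -_ (-1^-neg k _) ⟩
    - - -1^ k · -1^ k · x   ≡⟨ solve 1 (λ a → :- (:- a) := a) refl _ ⟩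
    -1^ k · -1^ k · x       ≡⟨ -1^-involutive k x ⟩
    x                       ∎

  -1^-sum : ∀ k {n} (f : Fin n → ℚ) → -1^ k · sum f ≡ ∑[ i < n ] (-1^ k · f i)
  -1^-sum k {zero}  f = -1^-zero k
  -1^-sum k {suc n} f = trans (-1^-distrib-+ k _ _) (cong ((-1^ k · f zero) +_) (-1^-sum k (f ∘ suc)))

  -1^-even : ∀ a c t x → a ℕ.+ c ≡ t ℕ.+ t → -1^ a · x ≡ -1^ c · x
  -1^-even a c t x eq = begin
    -1^ a · x                      ≡⟨ cong (-1^ a ·_) (sym (-1^-involutive c x)) ⟩
    -1^ a · -1^ c · -1^ c · x      ≡⟨ sym (-1^-+ a c _) ⟩
    -1^ (a ℕ.+ c) · -1^ c · x      ≡⟨ cong (λ s → -1^ s · -1^ c · x) eq ⟩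
    -1^ (t ℕ.+ t) · -1^ c · x      ≡⟨ -1^-+ t t _ ⟩
    -1^ t · -1^ t · -1^ c · x      ≡⟨ -1^-involutive t _ ⟩
    -1^ c · x                      ∎

  -1^-odd : ∀ a c t x → a ℕ.+ c ≡ suc (t ℕ.+ t) → -1^ a · x ≡ - -1^ c · x
  -1^-odd a c t x eq = trans (-1^-even a (suc c) (suc t) x
    (trans (ℕₚ.+-suc a c) (trans (cong suc eq) (cong suc (sym (ℕₚ.+-suc t t)))))) refl

  ∑-zero : ∀ {n} {f : Fin n → ℚ} → (∀ i → f i ≡ 0ℚ) → sum f ≡ 0ℚ
  ∑-zero {n} f≡0 = trans (sum-cong-≗ f≡0) (sum-replicate-zero n)

  ∑-neg : ∀ {n} (f : Fin n → ℚ) → ∑[ i < n ] (- f i) ≡ - sum f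
  ∑-neg {zero}  f = refl
  ∑-neg {suc n} f = trans (cong (- f zero +_) (∑-neg (f ∘ suc))) (sym (ℚₚ.neg-distrib-+ (f zero) (sum (f ∘ suc))))

  x≡-x⇒x≡0 : ∀ x → x ≡ - x → x ≡ 0ℚ
  x≡-x⇒x≡0 x eq = begin
    x                  ≡⟨ solve 1 (λ a → a := con ½ :* (a :+ a)) refl x ⟩
    ½ * (x + x)        ≡⟨ cong (λ y → ½ * (x + y)) eq ⟩
    ½ * (x + - x)      ≡⟨ solve 1 (λ a → con ½ :* (a :+ :- a) := con 0ℚ) refl x ⟩
    0ℚ                 ∎
    where open Data.Rational using (½)

  -- Integrals and their derivatives are handled as functionals φ on monomials (exponent vectors).
  eval : ∀ {m} → (Vec ℕ m → ℚ) → Poly m → ℚ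
  eval φ p = List.foldr _+_ 0ℚ (List.map (λ { (c , a) → c * φ a }) p)

  integralSimplex≡eval : ∀ {n} (p : Poly n) → integralSimplex p ≡ eval (intMonomial n) p
  integralSimplex≡eval p = refl

  eval-+P : ∀ {m} (φ : Vec ℕ m → ℚ) p q → eval φ (p +P q) ≡ eval φ p + eval φ q
  eval-+P φ []            q = sym (ℚₚ.+-identityˡ _)
  eval-+P φ ((c , a) ∷ p) q = trans (cong (c * φ a +_) (eval-+P φ p q)) (sym (ℚₚ.+-assoc (c * φ a) _ _))

  eval-negP : ∀ {m} (φ : Vec ℕ m → ℚ) p → eval φ (negP p) ≡ - eval φ p
  eval-negP φ []            = refl
  eval-negP φ ((c , a) ∷ p) = trans (cong ((- c) * φ a +_) (eval-negP φ p))
    (solve 3 (λ x y z → (:- x) :* y :+ (:- z) := :- (x :* y :+ z)) refl c (φ a) (eval φ p))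

  eval-signP : ∀ {m} (φ : Vec ℕ m → ℚ) k p → eval φ (signP k p) ≡ -1^ k · eval φ p
  eval-signP φ zero    p = refl
  eval-signP φ (suc k) p = trans (eval-negP φ (signP k p)) (cong -_ (eval-signP φ k p))

  shift : ∀ {m} → Fin m → ℕ → (Vec ℕ m → ℚ) → Vec ℕ m → ℚ
  shift v c φ b = φ (b [ v ]%= (c ℕ.+_))

  varPow-exponent : ∀ {m} (v : Fin m) c b →
    Vec.zipWith ℕ._+_ (Vec.tabulate (λ i → if ⌊ i Fin.≟ v ⌋ then c else 0)) b ≡ b [ v ]%= (c ℕ.+_)
  varPow-exponent zero    c (x ∷ b) = cong ((c ℕ.+ x) ∷_) (zeros b)
    where
    zeros : ∀ {k} (b : Vec ℕ k) → Vec.zipWith ℕ._+_ (Vec.tabulate (λ (i : Fin k) → 0)) b ≡ b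
    zeros []      = refl
    zeros (y ∷ b) = cong (y ∷_) (zeros b)
  varPow-exponent (suc v) c (x ∷ b) = cong (x ∷_) (trans
    (cong (λ t → Vec.zipWith ℕ._+_ t b) (Vecₚ.tabulate-cong λ i → cong (if_then c else 0) (≟-suc i)))
    (varPow-exponent v c b))
    where
    ≟-suc : ∀ i → ⌊ suc i Fin.≟ suc v ⌋ ≡ ⌊ i Fin.≟ v ⌋
    ≟-suc i with i Fin.≟ v
    ... | yes _ = refl
    ... | no  _ = refl

  eval-varPow-*P : ∀ {m} (φ : Vec ℕ m → ℚ) v c q → eval φ (varPow v c *P q) ≡ eval (shift v c φ) q
  eval-varPow-*P φ v c q = begin
    eval φ (times q List.++ [])  ≡⟨ cong (eval φ) (Listₚ.++-identityʳ (times q)) ⟩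
    eval φ (times q)             ≡⟨ go q ⟩
    eval (shift v c φ) q         ∎
    where
    δ = Vec.tabulate (λ i → if ⌊ i Fin.≟ v ⌋ then c else 0)
    times : Poly _ → Poly _
    times = List.map (λ { (d , b) → (1ℚ * d , Vec.zipWith ℕ._+_ δ b) })
    go : ∀ q → eval φ (times q) ≡ eval (shift v c φ) q
    go []            = refl
    go ((d , b) ∷ q) = cong₂ _+_ (cong₂ _*_ (ℚₚ.*-identityˡ d) (cong φ (varPow-exponent v c b))) (go q)

  eval-sumFin : ∀ {m K} (φ : Vec ℕ m → ℚ) k (g : Fin k → Fin K) (f : Fin K → Poly m) →
    eval φ (List.foldr _+P_ [] (List.map f (List.tabulate g))) ≡ ∑[ j < k ] eval φ (f (g j))
  eval-sumFin φ zero    g f = refl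
  eval-sumFin φ (suc k) g f =
    trans (eval-+P φ (f (g zero)) _) (cong (eval φ (f (g zero)) +_) (eval-sumFin φ k (g ∘ suc) f))

  alternant : ∀ {m} k → (Fin k → Fin m) → (Fin k → ℕ) → (Vec ℕ m → ℚ) → ℚ
  minor     : ∀ {m} k → (Fin (suc k) → Fin m) → (Fin (suc k) → ℕ) → (Vec ℕ m → ℚ) → Fin (suc k) → ℚ

  alternant zero    ρ e φ = φ (Vec.replicate _ 0)
  alternant (suc k) ρ e φ = ∑[ j < suc k ] (-1^ toℕ j · minor k ρ e φ j)

  minor k ρ e φ j = alternant k (ρ ∘ punchIn j) (e ∘ suc) (shift (ρ j) (e zero) φ)

  eval-det : ∀ {m} k (ρ : Fin k → Fin m) e (φ : Vec ℕ m → ℚ) →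
    eval φ (det k (λ i l → varPow (ρ l) (e i))) ≡ alternant k ρ e φ
  eval-det zero    ρ e φ = trans (ℚₚ.+-identityʳ _) (ℚₚ.*-identityˡ _)
  eval-det (suc k) ρ e φ = trans (eval-sumFin φ (suc k) id term) (sum-cong-≗ λ j → begin
    eval φ (signP (toℕ j) (varPow (ρ j) (e zero) *P M j))           ≡⟨ eval-signP φ (toℕ j) _ ⟩
    -1^ toℕ j · eval φ (varPow (ρ j) (e zero) *P M j)               ≡⟨ cong (-1^ toℕ j ·_) (eval-varPow-*P φ (ρ j) (e zero) (M j)) ⟩
    -1^ toℕ j · eval (shift (ρ j) (e zero) φ) (M j)                 ≡⟨ cong (-1^ toℕ j ·_) (eval-det k (ρ ∘ punchIn j) (e ∘ suc) _) ⟩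
    -1^ toℕ j · minor k ρ e φ j                                      ∎)
    where
    M : Fin (suc k) → Poly _
    M j = det k (λ i l → varPow (ρ (punchIn j l)) (e (suc i)))
    term : Fin (suc k) → Poly _
    term j = signP (toℕ j) (varPow (ρ j) (e zero) *P M j)

  alternant-cong : ∀ {m} k {ρ ρ′ : Fin k → Fin m} {e e′ : Fin k → ℕ} {φ ψ : Vec ℕ m → ℚ} →
    (∀ i → ρ i ≡ ρ′ i) → (∀ i → e i ≡ e′ i) → (∀ b → φ b ≡ ψ b) → alternant k ρ e φ ≡ alternant k ρ′ e′ ψ
  alternant-cong zero    ρ≗ρ′ e≗e′ φ≗ψ = φ≗ψ _
  alternant-cong (suc k) {ρ′ = ρ′} {e′ = e′} {φ} ρ≗ρ′ e≗e′ φ≗ψ = sum-cong-≗ λ j → cong (-1^ toℕ j ·_)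
    (alternant-cong k (ρ≗ρ′ ∘ punchIn j) (e≗e′ ∘ suc) λ b →
      trans (cong₂ (λ v c → φ (b [ v ]%= (c ℕ.+_))) (ρ≗ρ′ j) (e≗e′ zero)) (φ≗ψ (b [ ρ′ j ]%= (e′ zero ℕ.+_))))

  alternant-congᶠ : ∀ {m} k (ρ : Fin k → Fin m) e {φ ψ : Vec ℕ m → ℚ} →
    (∀ b → φ b ≡ ψ b) → alternant k ρ e φ ≡ alternant k ρ e ψ
  alternant-congᶠ k ρ e = alternant-cong k (λ _ → refl) (λ _ → refl)

  alternant-congᵉ : ∀ {m} k (ρ : Fin k → Fin m) {e e′ : Fin k → ℕ} (φ : Vec ℕ m → ℚ) →
    (∀ i → e i ≡ e′ i) → alternant k ρ e φ ≡ alternant k ρ e′ φ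
  alternant-congᵉ k ρ φ e≗e′ = alternant-cong k (λ _ → refl) e≗e′ (λ _ → refl)

  alternant-zero : ∀ {m} k (ρ : Fin k → Fin m) e {φ : Vec ℕ m → ℚ} → (∀ b → φ b ≡ 0ℚ) → alternant k ρ e φ ≡ 0ℚ
  alternant-zero zero    ρ e φ≡0 = φ≡0 _
  alternant-zero (suc k) ρ e φ≡0 = ∑-zero λ j →
    trans (cong (-1^ toℕ j ·_) (alternant-zero k (ρ ∘ punchIn j) (e ∘ suc) λ b → φ≡0 (b [ ρ j ]%= (e zero ℕ.+_)))) (-1^-zero (toℕ j))

  alternant-+ : ∀ {m} k (ρ : Fin k → Fin m) e (φ ψ : Vec ℕ m → ℚ) →
    alternant k ρ e (λ b → φ b + ψ b) ≡ alternant k ρ e φ + alternant k ρ e ψ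
  alternant-+ zero    ρ e φ ψ = refl
  alternant-+ (suc k) ρ e φ ψ = trans
    (sum-cong-≗ λ j → trans
      (cong (-1^ toℕ j ·_) (alternant-+ k (ρ ∘ punchIn j) (e ∘ suc) (shift (ρ j) (e zero) φ) (shift (ρ j) (e zero) ψ)))
      (-1^-distrib-+ (toℕ j) (minor k ρ e φ j) (minor k ρ e ψ j)))
    (∑-distrib-+ (λ j → -1^ toℕ j · minor k ρ e φ j) (λ j → -1^ toℕ j · minor k ρ e ψ j))

  sum-updateAt-+ : ∀ {m} (v : Fin m) c (b : Vec ℕ m) → Vec.sum (b [ v ]%= (c ℕ.+_)) ≡ c ℕ.+ Vec.sum b
  sum-updateAt-+ zero    c (x ∷ b) = ℕₚ.+-assoc c x _
  sum-updateAt-+ (suc v) c (x ∷ b) = begin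
    x ℕ.+ Vec.sum (b [ v ]%= (c ℕ.+_)) ≡⟨ cong (x ℕ.+_) (sum-updateAt-+ v c b) ⟩
    x ℕ.+ (c ℕ.+ Vec.sum b)            ≡⟨ ℕ-+-leftComm x c _ ⟩
    c ℕ.+ (x ℕ.+ Vec.sum b)            ∎

  sum-replicate-0 : ∀ m → Vec.sum (Vec.replicate m 0) ≡ 0
  sum-replicate-0 zero    = refl
  sum-replicate-0 (suc m) = sum-replicate-0 m

  alternant-degree : ∀ {m} k (ρ : Fin k → Fin m) e (g : ℕ → ℚ) (φ : Vec ℕ m → ℚ) →
    alternant k ρ e (λ b → g (Vec.sum b) * φ b) ≡ g (Vec.sum (Vec.tabulate e)) * alternant k ρ e φ
  alternant-degree {m} zero ρ e g φ = cong (λ s → g s * φ (Vec.replicate m 0)) (sum-replicate-0 m)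
  alternant-degree (suc k) ρ e g φ = trans (sum-cong-≗ λ j → begin
      -1^ toℕ j · alternant k (ρ ∘ punchIn j) (e ∘ suc) (λ b → g (Vec.sum (b [ ρ j ]%= (e zero ℕ.+_))) * shift (ρ j) (e zero) φ b)
        ≡⟨ cong (-1^ toℕ j ·_) (alternant-congᶠ k (ρ ∘ punchIn j) (e ∘ suc)
             λ b → cong (λ s → g s * shift (ρ j) (e zero) φ b) (sum-updateAt-+ (ρ j) (e zero) b)) ⟩
      -1^ toℕ j · alternant k (ρ ∘ punchIn j) (e ∘ suc) (λ b → g (e zero ℕ.+ Vec.sum b) * shift (ρ j) (e zero) φ b)
        ≡⟨ cong (-1^ toℕ j ·_) (alternant-degree k (ρ ∘ punchIn j) (e ∘ suc) (λ s → g (e zero ℕ.+ s)) (shift (ρ j) (e zero) φ)) ⟩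
      -1^ toℕ j · (g (Vec.sum (Vec.tabulate e)) * minor k ρ e φ j)
        ≡⟨ -1^-*-comm (toℕ j) (g (Vec.sum (Vec.tabulate e))) (minor k ρ e φ j) ⟩
      g (Vec.sum (Vec.tabulate e)) * -1^ toℕ j · minor k ρ e φ j ∎)
    (sym (*-distribˡ-sum (g (Vec.sum (Vec.tabulate e))) (λ j → -1^ toℕ j · minor k ρ e φ j)))

  -- `∂ φ` is the functional φ ∘ ∑_w ∂/∂x_w.
  ∂ : ∀ {m} → (Vec ℕ m → ℚ) → Vec ℕ m → ℚ
  ∂ {m} φ b = ∑[ w < m ] (ι (Vec.lookup b w) * φ (b [ w ]%= ℕ.pred))

  leibniz : ∀ (Φ : ℕ → ℚ) c x →
    ι (c ℕ.+ x) * Φ (ℕ.pred (c ℕ.+ x)) ≡ ι x * Φ (c ℕ.+ ℕ.pred x) + ι c * Φ (ℕ.pred c ℕ.+ x)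
  leibniz Φ zero zero = solve 1 (λ a → con 0ℚ :* a := con 0ℚ :* a :+ con 0ℚ :* a) refl (Φ 0)
  leibniz Φ zero (suc x) = solve 2 (λ i a → i :* a := i :* a :+ con 0ℚ :* con (Φ (suc x))) refl (ι (suc x)) (Φ x)
  leibniz Φ (suc c) zero rewrite ℕₚ.+-identityʳ c =
    solve 2 (λ i a → i :* a := con 0ℚ :* con (Φ (suc c)) :+ i :* a) refl (ι (suc c)) (Φ c)
  leibniz Φ (suc c) (suc x) = begin
    ι (suc c ℕ.+ suc x) * Φ (c ℕ.+ suc x)
      ≡⟨ cong (_* Φ (c ℕ.+ suc x)) (ι-+ (suc c) (suc x)) ⟩
    (ι (suc c) + ι (suc x)) * Φ (c ℕ.+ suc x)
      ≡⟨ solve 3 (λ i j a → (i :+ j) :* a := j :* a :+ i :* a) refl (ι (suc c)) (ι (suc x)) (Φ (c ℕ.+ suc x)) ⟩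
    ι (suc x) * Φ (c ℕ.+ suc x) + ι (suc c) * Φ (c ℕ.+ suc x)
      ≡⟨ cong (λ y → ι (suc x) * Φ y + ι (suc c) * Φ (c ℕ.+ suc x)) (ℕₚ.+-suc c x) ⟩
    ι (suc x) * Φ (suc c ℕ.+ x) + ι (suc c) * Φ (c ℕ.+ suc x) ∎

  updateAt-≔ : ∀ {m} (v : Fin m) (b : Vec ℕ m) {f : ℕ → ℕ} → b [ v ]%= f ≡ b [ v ]%= (λ _ → f (Vec.lookup b v))
  updateAt-≔ v b = Vecₚ.updateAt-cong-local v b refl

  shift-∂-at : ∀ {m} (v : Fin m) c b (φ : Vec ℕ m → ℚ) →
    ι (Vec.lookup (b [ v ]%= (c ℕ.+_)) v) * φ (b [ v ]%= (c ℕ.+_) [ v ]%= ℕ.pred) ≡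
    ι (Vec.lookup b v) * φ (b [ v ]%= ℕ.pred [ v ]%= (c ℕ.+_)) + ι c * φ (b [ v ]%= (ℕ.pred c ℕ.+_))
  shift-∂-at v c b φ = begin
    ι (Vec.lookup (b [ v ]%= (c ℕ.+_)) v) * φ (b [ v ]%= (c ℕ.+_) [ v ]%= ℕ.pred)
      ≡⟨ cong₂ (λ y b′ → ι y * φ b′) (Vecₚ.lookup∘updateAt v b) (trans (Vecₚ.updateAt-updateAt v b) (updateAt-≔ v b)) ⟩
    ι (c ℕ.+ x) * Φ (ℕ.pred (c ℕ.+ x))
      ≡⟨ leibniz Φ c x ⟩
    ι x * Φ (c ℕ.+ ℕ.pred x) + ι c * Φ (ℕ.pred c ℕ.+ x)
      ≡⟨ sym (cong₂ (λ b′ b″ → ι x * φ b′ + ι c * φ b″)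
           (trans (Vecₚ.updateAt-updateAt v b) (updateAt-≔ v b)) (updateAt-≔ v b)) ⟩
    ι x * φ (b [ v ]%= ℕ.pred [ v ]%= (c ℕ.+_)) + ι c * φ (b [ v ]%= (ℕ.pred c ℕ.+_)) ∎
    where
    x = Vec.lookup b v
    Φ : ℕ → ℚ
    Φ y = φ (b [ v ]%= λ _ → y)

  shift-∂ : ∀ {m} (v : Fin m) c b (φ : Vec ℕ m → ℚ) →
    shift v c (∂ φ) b ≡ ∂ (shift v c φ) b + ι c * shift v (ℕ.pred c) φ b
  shift-∂ {suc m} v c b φ = begin
    ∂ φ (b [ v ]%= (c ℕ.+_))
      ≡⟨ sum-remove {i = v} (λ w → ι (Vec.lookup (b [ v ]%= (c ℕ.+_)) w) * φ (b [ v ]%= (c ℕ.+_) [ w ]%= ℕ.pred)) ⟩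
    ι (Vec.lookup (b [ v ]%= (c ℕ.+_)) v) * φ (b [ v ]%= (c ℕ.+_) [ v ]%= ℕ.pred) + S
      ≡⟨ cong₂ _+_ (shift-∂-at v c b φ) (sum-cong-≗ other) ⟩
    (X + Y) + S′
      ≡⟨ solve 3 (λ x y s → (x :+ y) :+ s := (x :+ s) :+ y) refl X Y S′ ⟩
    (X + S′) + Y
      ≡⟨ cong (_+ Y) (sym (sum-remove {i = v} (λ w → ι (Vec.lookup b w) * shift v c φ (b [ w ]%= ℕ.pred)))) ⟩
    ∂ (shift v c φ) b + Y ∎
    where
    X = ι (Vec.lookup b v) * φ (b [ v ]%= ℕ.pred [ v ]%= (c ℕ.+_))
    Y = ι c * φ (b [ v ]%= (ℕ.pred c ℕ.+_))
    S = ∑[ w < m ] (ι (Vec.lookup (b [ v ]%= (c ℕ.+_)) (punchIn v w)) * φ (b [ v ]%= (c ℕ.+_) [ punchIn v w ]%= ℕ.pred))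
    S′ = ∑[ w < m ] (ι (Vec.lookup b (punchIn v w)) * φ (b [ punchIn v w ]%= ℕ.pred [ v ]%= (c ℕ.+_)))
    other : ∀ w → ι (Vec.lookup (b [ v ]%= (c ℕ.+_)) (punchIn v w)) * φ (b [ v ]%= (c ℕ.+_) [ punchIn v w ]%= ℕ.pred)
                ≡ ι (Vec.lookup b (punchIn v w)) * φ (b [ punchIn v w ]%= ℕ.pred [ v ]%= (c ℕ.+_))
    other w = cong₂ (λ y b′ → ι y * φ b′)
      (Vecₚ.lookup∘updateAt′ (punchIn v w) v (Finₚ.punchInᵢ≢i v w) b)
      (Vecₚ.updateAt-commutes (punchIn v w) v (Finₚ.punchInᵢ≢i v w) b)

  minor-∂ : ∀ {m} k (ρ : Fin (suc k) → Fin m) e (φ : Vec ℕ m → ℚ) j →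
    minor k ρ e (∂ φ) j ≡ ∑[ i < suc k ] (ι (e i) * minor k ρ (updateAt e i ℕ.pred) φ j)
  alternant-∂ : ∀ {m} k (ρ : Fin k → Fin m) e (φ : Vec ℕ m → ℚ) →
    alternant k ρ e (∂ φ) ≡ ∑[ i < k ] (ι (e i) * alternant k ρ (updateAt e i ℕ.pred) φ)

  minor-∂ k ρ e φ j = begin
    alternant k ρj (e ∘ suc) (shift (ρ j) (e zero) (∂ φ))
      ≡⟨ alternant-congᶠ k ρj (e ∘ suc) (λ b → shift-∂ (ρ j) (e zero) b φ) ⟩
    alternant k ρj (e ∘ suc) (λ b → ∂ (shift (ρ j) (e zero) φ) b + ι (e zero) * shift (ρ j) (ℕ.pred (e zero)) φ b)
      ≡⟨ alternant-+ k ρj (e ∘ suc) _ _ ⟩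
    alternant k ρj (e ∘ suc) (∂ (shift (ρ j) (e zero) φ)) + alternant k ρj (e ∘ suc) (λ b → ι (e zero) * shift (ρ j) (ℕ.pred (e zero)) φ b)
      ≡⟨ cong₂ _+_ (alternant-∂ k ρj (e ∘ suc) _) (alternant-degree k ρj (e ∘ suc) (λ _ → ι (e zero)) _) ⟩
    ∑[ i < k ] (ι (e (suc i)) * minor k ρ (updateAt e (suc i) ℕ.pred) φ j) + ι (e zero) * minor k ρ (updateAt e zero ℕ.pred) φ j
      ≡⟨ ℚₚ.+-comm _ (ι (e zero) * minor k ρ (updateAt e zero ℕ.pred) φ j) ⟩
    ∑[ i < suc k ] (ι (e i) * minor k ρ (updateAt e i ℕ.pred) φ j) ∎
    where ρj = ρ ∘ punchIn j

  alternant-∂ {m} zero ρ e φ = ∑-zero λ w →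
    trans (cong (λ y → ι y * φ (Vec.replicate m 0 [ w ]%= ℕ.pred)) (Vecₚ.lookup-replicate w 0)) (ℚₚ.*-zeroˡ (φ (Vec.replicate m 0 [ w ]%= ℕ.pred)))
  alternant-∂ (suc k) ρ e φ = begin
    ∑[ j < suc k ] (-1^ toℕ j · minor k ρ e (∂ φ) j)
      ≡⟨ sum-cong-≗ (λ j → begin
           -1^ toℕ j · minor k ρ e (∂ φ) j
             ≡⟨ cong (-1^ toℕ j ·_) (minor-∂ k ρ e φ j) ⟩
           -1^ toℕ j · ∑[ i < suc k ] (ι (e i) * M i j)
             ≡⟨ -1^-sum (toℕ j) (λ i → ι (e i) * M i j) ⟩
           ∑[ i < suc k ] (-1^ toℕ j · (ι (e i) * M i j))
             ≡⟨ sum-cong-≗ (λ i → -1^-*-comm (toℕ j) (ι (e i)) (M i j)) ⟩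
           ∑[ i < suc k ] (ι (e i) * -1^ toℕ j · M i j) ∎) ⟩
    ∑[ j < suc k ] ∑[ i < suc k ] (ι (e i) * -1^ toℕ j · M i j)
      ≡⟨ ∑-comm (λ j i → ι (e i) * -1^ toℕ j · M i j) ⟩
    ∑[ i < suc k ] ∑[ j < suc k ] (ι (e i) * -1^ toℕ j · M i j)
      ≡⟨ sum-cong-≗ (λ i → sym (*-distribˡ-sum (ι (e i)) (λ j → -1^ toℕ j · M i j))) ⟩
    ∑[ i < suc k ] (ι (e i) * alternant (suc k) ρ (updateAt e i ℕ.pred) φ) ∎
    where
    M : Fin (suc k) → Fin (suc k) → ℚ
    M i = minor k ρ (updateAt e i ℕ.pred) φ

  whenZero : ℕ → ℚ → ℚ
  whenZero zero    q = q
  whenZero (suc _) q = 0ℚ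

  -- ψ restricted to the face x_v = 0: a monomial survives iff its x_v-exponent is 0.
  onFace : ∀ {m} → Fin m → (Vec ℕ m → ℚ) → Vec ℕ m → ℚ
  onFace v ψ b = whenZero (Vec.lookup b v) (ψ b)

  1/suc : ℕ → ℚ
  1/suc a = +ℤ 1 / suc a

  ∂-intMonomial-first : ∀ (Ψ : ℕ → ℚ) x → ι x * (1/suc (ℕ.pred x) * Ψ (suc (ℕ.pred x))) + whenZero x (Ψ 0) ≡ Ψ x
  ∂-intMonomial-first Ψ zero    = solve 1 (λ a → con 0ℚ :* (con (1/suc 0) :* con (Ψ 1)) :+ a := a) refl (Ψ 0)
  ∂-intMonomial-first Ψ (suc x) = begin
    ι (suc x) * (1/suc x * Ψ (suc x)) + 0ℚ ≡⟨ solve 3 (λ i r a → i :* (r :* a) :+ con 0ℚ := (r :* i) :* a) refl (ι (suc x)) (1/suc x) (Ψ (suc x)) ⟩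
    (1/suc x * ι (suc x)) * Ψ (suc x)     ≡⟨ cong (_* Ψ (suc x)) (1/suc-*-ι x) ⟩
    1ℚ * Ψ (suc x)                        ≡⟨ ℚₚ.*-identityˡ (Ψ (suc x)) ⟩
    Ψ (suc x)                             ∎

  ∂-intMonomial-second : ∀ (Ψ : ℕ → ℚ) x y → ι y * Ψ (suc x ℕ.+ ℕ.pred y) ≡ ι y * Ψ (x ℕ.+ y)
  ∂-intMonomial-second Ψ x zero    = trans (ℚₚ.*-zeroˡ (Ψ (suc x ℕ.+ 0))) (sym (ℚₚ.*-zeroˡ (Ψ (x ℕ.+ 0))))
  ∂-intMonomial-second Ψ x (suc y) = cong (λ z → ι (suc y) * Ψ z) (sym (ℕₚ.+-suc x y))

  ∂-intMonomial-algebra : ∀ T W P Y R U S NQ → T + W ≡ P → R * U ≡ 1ℚ → (U + Y) * P + S ≡ NQ →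
    (T + (Y * (R * P) + R * S)) + W ≡ R * NQ
  ∂-intMonomial-algebra T W P Y R U S NQ TW≡P RU≡1 IH = begin
    (T + (Y * (R * P) + R * S)) + W  ≡⟨ solve 6 (λ t w y r p s → (t :+ (y :* (r :* p) :+ r :* s)) :+ w := (t :+ w) :+ r :* (y :* p :+ s)) refl T W Y R P S ⟩
    (T + W) + R * (Y * P + S)        ≡⟨ cong (λ z → z + R * (Y * P + S)) (trans TW≡P (sym (ℚₚ.*-identityˡ P))) ⟩
    1ℚ * P + R * (Y * P + S)         ≡⟨ cong (λ z → z * P + R * (Y * P + S)) (sym RU≡1) ⟩
    (R * U) * P + R * (Y * P + S)    ≡⟨ solve 5 (λ r u p y s → (r :* u) :* p :+ r :* (y :* p :+ s) := r :* ((u :+ y) :* p :+ s)) refl R U P Y S ⟩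
    R * ((U + Y) * P + S)            ≡⟨ cong (R *_) IH ⟩
    R * NQ                           ∎

  -- Divergence theorem for the field (f, …, f) on 0 ≤ x_0 ≤ … ≤ x_n ≤ 1: the faces x_i = x_{i+1}
  -- carry no flux, the face x_n = 1 contributes (deg f + n + 1) ∫ f by homogeneity, and x_0 = 0 the rest.
  ∂-intMonomial : ∀ n (b : Vec ℕ (suc n)) →
    ∂ (intMonomial (suc n)) b + onFace zero (intMonomial n ∘ Vec.tail) b ≡ ι (Vec.sum b ℕ.+ suc n) * intMonomial (suc n) b
  ∂-intMonomial zero (zero ∷ [])  = refl
  ∂-intMonomial zero (suc y ∷ []) = begin
    (ι (suc y) * 1/suc y + 0ℚ) + 0ℚ ≡⟨ solve 2 (λ i r → (i :* r :+ con 0ℚ) :+ con 0ℚ := r :* i) refl (ι (suc y)) (1/suc y) ⟩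
    1/suc y * ι (suc y)             ≡⟨ trans (1/suc-*-ι y) (sym (1/suc-*-ι (suc y))) ⟩
    1/suc (suc y) * ι (suc (suc y)) ≡⟨ solve 2 (λ r i → r :* i := i :* r) refl (1/suc (suc y)) (ι (suc (suc y))) ⟩
    ι (suc (suc y)) * 1/suc (suc y) ≡⟨ cong (λ s → ι s * 1/suc (suc y)) (sym size≡) ⟩
    ι (suc y ℕ.+ 0 ℕ.+ 1) * 1/suc (suc y) ∎
    where
    size≡ : suc y ℕ.+ 0 ℕ.+ 1 ≡ suc (suc y)
    size≡ = cong suc (trans (ℕₚ.+-comm (y ℕ.+ 0) 1) (cong suc (ℕₚ.+-identityʳ y)))
  ∂-intMonomial (suc m) (x ∷ y ∷ rest) = begin
    (T + (ι y * (R * J (suc x ℕ.+ ℕ.pred y ∷ rest)) + ∑[ w < m ] (ι (Vec.lookup rest w) * (R * J (c ∷ rest [ w ]%= ℕ.pred)))))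
      + whenZero x (J (y ∷ rest))
      ≡⟨ cong (λ z → (T + z) + whenZero x (J (y ∷ rest))) (cong₂ _+_
           (∂-intMonomial-second (λ z → R * J (z ∷ rest)) x y)
           (trans (sum-cong-≗ λ w → solve 3 (λ a r j → a :* (r :* j) := r :* (a :* j)) refl (ι (Vec.lookup rest w)) R (J (c ∷ rest [ w ]%= ℕ.pred)))
                  (sym (*-distribˡ-sum R (λ w → ι (Vec.lookup rest w) * J (c ∷ rest [ w ]%= ℕ.pred)))))) ⟩
    (T + (ι y * (R * P) + R * S)) + whenZero x (J (y ∷ rest))
      ≡⟨ ∂-intMonomial-algebra T (whenZero x (J (y ∷ rest))) P (ι y) R (ι (suc x)) S (N * J (c ∷ rest))
           (∂-intMonomial-first (λ z → J (z ℕ.+ y ∷ rest)) x) (1/suc-*-ι x)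
           (trans (cong (λ z → z * P + S) (sym (ι-+ (suc x) y)))
             (trans (sym (ℚₚ.+-identityʳ (ι (suc x ℕ.+ y) * P + S))) (∂-intMonomial m (c ∷ rest)))) ⟩
    R * (N * J (c ∷ rest))
      ≡⟨ solve 3 (λ r n q → r :* (n :* q) := n :* (r :* q)) refl R N (J (c ∷ rest)) ⟩
    N * (R * J (c ∷ rest))
      ≡⟨ cong (λ s → ι s * (R * J (c ∷ rest))) size≡ ⟩
    ι (Vec.sum (x ∷ y ∷ rest) ℕ.+ suc (suc m)) * (R * J (c ∷ rest)) ∎
    where
    J = intMonomial (suc m)
    R = 1/suc x
    c = suc x ℕ.+ y
    P = J (x ℕ.+ y ∷ rest)
    T = ι x * (1/suc (ℕ.pred x) * J (suc (ℕ.pred x) ℕ.+ y ∷ rest))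
    S = ∑[ w < m ] (ι (Vec.lookup rest w) * J (c ∷ rest [ w ]%= ℕ.pred))
    N = ι (Vec.sum (c ∷ rest) ℕ.+ suc m)
    size≡ : Vec.sum (c ∷ rest) ℕ.+ suc m ≡ Vec.sum (x ∷ y ∷ rest) ℕ.+ suc (suc m)
    size≡ = trans (cong (λ z → suc (z ℕ.+ suc m)) (ℕₚ.+-assoc x y (Vec.sum rest))) (sym (ℕₚ.+-suc (x ℕ.+ (y ℕ.+ Vec.sum rest)) (suc m)))

  punchIn-punchOut-swap : ∀ {k} {a c : Fin (suc (suc k))} (a≢c : a ≢ c) (c≢a : c ≢ a) (x : Fin k) →
    punchIn a (punchIn (punchOut a≢c) x) ≡ punchIn c (punchIn (punchOut c≢a) x)
  punchIn-punchOut-swap {a = zero}  {zero}  a≢c c≢a x = ⊥-elim (a≢c refl)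
  punchIn-punchOut-swap {a = zero}  {suc c} a≢c c≢a x = refl
  punchIn-punchOut-swap {a = suc a} {zero}  a≢c c≢a x = refl
  punchIn-punchOut-swap {zero}  {suc zero} {suc zero} a≢c c≢a x = ⊥-elim (a≢c refl)
  punchIn-punchOut-swap {suc k} {suc a} {suc c} a≢c c≢a zero    = refl
  punchIn-punchOut-swap {suc k} {suc a} {suc c} a≢c c≢a (suc x) =
    cong suc (punchIn-punchOut-swap (a≢c ∘ cong suc) (c≢a ∘ cong suc) x)

  punchOut-+ : ∀ {k} {a c : Fin (suc k)} (a≢c : a ≢ c) (c≢a : c ≢ a) →
    suc (toℕ (punchOut a≢c) ℕ.+ toℕ (punchOut c≢a)) ≡ toℕ a ℕ.+ toℕ c
  punchOut-+ {a = zero} {zero}  a≢c c≢a = ⊥-elim (a≢c refl)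
  punchOut-+ {suc k} {zero}  {suc c} a≢c c≢a = cong suc (ℕₚ.+-identityʳ (toℕ c))
  punchOut-+ {suc k} {suc a} {zero}  a≢c c≢a = cong suc (sym (ℕₚ.+-identityʳ (toℕ a)))
  punchOut-+ {suc k} {suc a} {suc c} a≢c c≢a = begin
    suc (suc x ℕ.+ suc y)   ≡⟨ cong (λ (z : ℕ) → suc (suc z)) (ℕₚ.+-suc x y) ⟩
    suc (suc (suc (x ℕ.+ y))) ≡⟨ cong (λ (z : ℕ) → suc (suc z)) (punchOut-+ (a≢c ∘ cong suc) (c≢a ∘ cong suc)) ⟩
    suc (suc (toℕ a ℕ.+ toℕ c)) ≡⟨ cong suc (sym (ℕₚ.+-suc (toℕ a) (toℕ c))) ⟩
    suc (toℕ a) ℕ.+ suc (toℕ c) ∎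
    where
    x = toℕ (punchOut (a≢c ∘ cong suc))
    y = toℕ (punchOut (c≢a ∘ cong suc))

  ∑∑-antisymmetric : ∀ {n} (H : Fin n → Fin n → ℚ) → (∀ a c → H a c ≡ - H c a) →
    ∑[ a < n ] ∑[ c < n ] H a c ≡ 0ℚ
  ∑∑-antisymmetric {n} H anti = x≡-x⇒x≡0 _ (begin
    ∑[ a < n ] ∑[ c < n ] H a c     ≡⟨ ∑-comm H ⟩
    ∑[ c < n ] ∑[ a < n ] H a c     ≡⟨ sum-cong-≗ (λ c → trans (sum-cong-≗ (λ a → anti a c)) (∑-neg (H c))) ⟩
    ∑[ c < n ] (- ∑[ a < n ] H c a) ≡⟨ ∑-neg (λ c → sum (H c)) ⟩
    - ∑[ a < n ] ∑[ c < n ] H a c   ∎)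

  updateAt-comm : ∀ {m} (v w : Fin m) (f : ℕ → ℕ) (b : Vec ℕ m) → b [ w ]%= f [ v ]%= f ≡ b [ v ]%= f [ w ]%= f
  updateAt-comm v w f b with v Fin.≟ w
  ... | yes refl = refl
  ... | no  v≢w  = Vecₚ.updateAt-commutes v w v≢w b

  alternant-equal-rows : ∀ {m} k (ρ : Fin (suc k) → Fin m) e (i : Fin k) →
    e (Fin.inject₁ i) ≡ e (suc i) → ∀ φ → alternant (suc k) ρ e φ ≡ 0ℚ
  alternant-equal-rows (suc k) ρ e (suc i) eq φ = ∑-zero λ j → trans
    (cong (-1^ toℕ j ·_) (alternant-equal-rows k (ρ ∘ punchIn j) (e ∘ suc) i eq (shift (ρ j) (e zero) φ))) (-1^-zero (toℕ j))
  alternant-equal-rows (suc k) ρ e zero eq φ = begin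
    ∑[ a < suc (suc k) ] (-1^ toℕ a · ∑[ b < suc k ] (-1^ toℕ b · Y a b))
      ≡⟨ sum-cong-≗ (λ a → trans (-1^-sum (toℕ a) (λ b → -1^ toℕ b · Y a b)) (sym (sum-via-H a))) ⟩
    ∑[ a < suc (suc k) ] ∑[ c < suc (suc k) ] H a c
      ≡⟨ ∑∑-antisymmetric H anti ⟩
    0ℚ ∎
    where
    Y : Fin (suc (suc k)) → Fin (suc k) → ℚ
    Y a b = alternant k (λ x → ρ (punchIn a (punchIn b x))) (λ i → e (suc (suc i))) (shift (ρ (punchIn a b)) (e (suc zero)) (shift (ρ a) (e zero) φ))
    G : Fin (suc (suc k)) → Fin (suc k) → ℚ
    G a b = -1^ toℕ a · -1^ toℕ b · Y a b
    H : Fin (suc (suc k)) → Fin (suc (suc k)) → ℚ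
    H a c with a Fin.≟ c
    ... | yes _   = 0ℚ
    ... | no  a≢c = G a (punchOut a≢c)
    sum-via-H : ∀ a → sum (H a) ≡ sum (G a)
    sum-via-H a = trans (sum-remove {i = a} (H a))
      (trans (cong₂ _+_ diagonal (sum-cong-≗ off-diagonal)) (ℚₚ.+-identityˡ (sum (G a))))
      where
      diagonal : H a a ≡ 0ℚ
      diagonal with a Fin.≟ a
      ... | yes _   = refl
      ... | no  a≢a = ⊥-elim (a≢a refl)
      off-diagonal : ∀ b → H a (punchIn a b) ≡ G a b
      off-diagonal b with a Fin.≟ punchIn a b
      ... | yes a≡ = ⊥-elim (Finₚ.punchInᵢ≢i a b (sym a≡))
      ... | no  a≢ = cong (G a) (trans (Finₚ.punchOut-cong a refl) (Finₚ.punchOut-punchIn a))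
    anti : ∀ a c → H a c ≡ - H c a
    anti a c with a Fin.≟ c | c Fin.≟ a
    ... | yes _   | yes _   = refl
    ... | yes a≡c | no  c≢a = ⊥-elim (c≢a (sym a≡c))
    ... | no  a≢c | yes c≡a = ⊥-elim (a≢c (sym c≡a))
    ... | no  a≢c | no  c≢a = begin
      -1^ toℕ a · -1^ toℕ (punchOut a≢c) · Y a (punchOut a≢c)
        ≡⟨ sym (-1^-+ (toℕ a) _ _) ⟩
      -1^ (toℕ a ℕ.+ toℕ (punchOut a≢c)) · Y a (punchOut a≢c)
        ≡⟨ -1^-odd (toℕ a ℕ.+ toℕ (punchOut a≢c)) (toℕ c ℕ.+ toℕ (punchOut c≢a)) t (Y a (punchOut a≢c)) parity ⟩
      - -1^ (toℕ c ℕ.+ toℕ (punchOut c≢a)) · Y a (punchOut a≢c)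
        ≡⟨ cong (λ z → - -1^ (toℕ c ℕ.+ toℕ (punchOut c≢a)) · z) Y-sym ⟩
      - -1^ (toℕ c ℕ.+ toℕ (punchOut c≢a)) · Y c (punchOut c≢a)
        ≡⟨ cong -_ (-1^-+ (toℕ c) _ _) ⟩
      - (-1^ toℕ c · -1^ toℕ (punchOut c≢a) · Y c (punchOut c≢a)) ∎
      where
      t = toℕ (punchOut a≢c) ℕ.+ toℕ (punchOut c≢a)
      parity : toℕ a ℕ.+ toℕ (punchOut a≢c) ℕ.+ (toℕ c ℕ.+ toℕ (punchOut c≢a)) ≡ suc (t ℕ.+ t)
      parity = begin
        toℕ a ℕ.+ toℕ (punchOut a≢c) ℕ.+ (toℕ c ℕ.+ toℕ (punchOut c≢a))
          ≡⟨ ℕ-+-interchange (toℕ a) (toℕ (punchOut a≢c)) (toℕ c) (toℕ (punchOut c≢a)) ⟩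
        (toℕ a ℕ.+ toℕ c) ℕ.+ t
          ≡⟨ cong (ℕ._+ t) (sym (punchOut-+ a≢c c≢a)) ⟩
        suc (t ℕ.+ t) ∎
      Y-sym : Y a (punchOut a≢c) ≡ Y c (punchOut c≢a)
      Y-sym = alternant-cong k (λ x → cong ρ (punchIn-punchOut-swap a≢c c≢a x)) (λ _ → refl) λ b → begin
        φ (b [ ρ (punchIn a (punchOut a≢c)) ]%= (e (suc zero) ℕ.+_) [ ρ a ]%= (e zero ℕ.+_))
          ≡⟨ cong₂ (λ u z → φ (b [ ρ u ]%= (z ℕ.+_) [ ρ a ]%= (e zero ℕ.+_))) (Finₚ.punchIn-punchOut a≢c) (sym eq) ⟩
        φ (b [ ρ c ]%= (e zero ℕ.+_) [ ρ a ]%= (e zero ℕ.+_))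
          ≡⟨ cong φ (updateAt-comm (ρ a) (ρ c) (e zero ℕ.+_) b) ⟩
        φ (b [ ρ a ]%= (e zero ℕ.+_) [ ρ c ]%= (e zero ℕ.+_))
          ≡⟨ cong₂ (λ u z → φ (b [ ρ u ]%= (z ℕ.+_) [ ρ c ]%= (e zero ℕ.+_))) (sym (Finₚ.punchIn-punchOut c≢a)) eq ⟩
        φ (b [ ρ (punchIn c (punchOut c≢a)) ]%= (e (suc zero) ℕ.+_) [ ρ c ]%= (e zero ℕ.+_)) ∎

  shift-onFace : ∀ {m} {w v : Fin m} c ψ → w ≢ v → ∀ b → shift w c (onFace v ψ) b ≡ onFace v (shift w c ψ) b
  shift-onFace {w = w} {v} c ψ w≢v b =
    cong (λ y → whenZero y (ψ (b [ w ]%= (c ℕ.+_)))) (Vecₚ.lookup∘updateAt′ v w (w≢v ∘ sym) b)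

  shift-onFace-self : ∀ {m} (v : Fin m) {c} ψ → 1 ≤ c → ∀ b → shift v c (onFace v ψ) b ≡ 0ℚ
  shift-onFace-self v {suc c} ψ _ b = cong (λ y → whenZero y (ψ (b [ v ]%= (suc c ℕ.+_)))) (Vecₚ.lookup∘updateAt v b)

  minor-onFace-self : ∀ {m} k (ρ : Fin (suc k) → Fin m) e ψ {v} p → ρ p ≡ v → 1 ≤ e zero →
    minor k ρ e (onFace v ψ) p ≡ 0ℚ
  minor-onFace-self k ρ e ψ p refl 1≤e₀ = alternant-zero k (ρ ∘ punchIn p) (e ∘ suc) (shift-onFace-self (ρ p) ψ 1≤e₀)

  minor-onFace : ∀ {m} k (ρ : Fin (suc k) → Fin m) e ψ {v} j → ρ j ≢ v →
    minor k ρ e (onFace v ψ) j ≡ alternant k (ρ ∘ punchIn j) (e ∘ suc) (onFace v (shift (ρ j) (e zero) ψ))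
  minor-onFace k ρ e ψ j ρj≢v = alternant-congᶠ k (ρ ∘ punchIn j) (e ∘ suc) (shift-onFace (e zero) ψ ρj≢v)

  injective-punchIn : ∀ {k m} {ρ : Fin (suc k) → Fin m} → Injective _≡_ _≡_ ρ → ∀ j → Injective _≡_ _≡_ (ρ ∘ punchIn j)
  injective-punchIn inj j eq = Finₚ.punchIn-injective j _ _ (inj eq)

  alternant-onFace-vanishes : ∀ {m} k (ρ : Fin (suc k) → Fin m) → Injective _≡_ _≡_ ρ → ∀ {v} p → ρ p ≡ v →
    ∀ e → (∀ i → 1 ≤ e i) → ∀ ψ → alternant (suc k) ρ e (onFace v ψ) ≡ 0ℚ
  minor-onFace-vanishes : ∀ {m} k (ρ : Fin (suc k) → Fin m) → Injective _≡_ _≡_ ρ → ∀ {v} p → ρ p ≡ v →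
    ∀ e → (∀ i → 1 ≤ e i) → ∀ ψ j → minor k ρ e (onFace v ψ) j ≡ 0ℚ

  alternant-onFace-vanishes k ρ inj p ρp e pos ψ = ∑-zero λ j →
    trans (cong (-1^ toℕ j ·_) (minor-onFace-vanishes k ρ inj p ρp e pos ψ j)) (-1^-zero (toℕ j))

  minor-onFace-vanishes zero ρ inj zero ρp e pos ψ zero = minor-onFace-self zero ρ e ψ zero ρp (pos zero)
  minor-onFace-vanishes (suc k) ρ inj p ρp e pos ψ j with j Fin.≟ p
  ... | yes refl = minor-onFace-self (suc k) ρ e ψ j ρp (pos zero)
  ... | no  j≢p  = trans (minor-onFace (suc k) ρ e ψ j (λ ρj≡v → j≢p (inj (trans ρj≡v (sym ρp)))))
    (alternant-onFace-vanishes k (ρ ∘ punchIn j) (injective-punchIn inj j) (punchOut j≢p)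
      (trans (cong ρ (Finₚ.punchIn-punchOut j≢p)) ρp) (e ∘ suc) (pos ∘ suc) (shift (ρ j) (e zero) ψ))

  private
    +-rearrange : ∀ j k B p j′ → j ℕ.+ (k ℕ.+ B) ℕ.+ (suc k ℕ.+ p ℕ.+ j′) ≡ (j ℕ.+ p) ℕ.+ ((B ℕ.+ j′) ℕ.+ (k ℕ.+ suc k))
    +-rearrange = solve-∀

    +-double : ∀ k u → suc u ℕ.+ (u ℕ.+ (k ℕ.+ suc k)) ≡ suc (k ℕ.+ u) ℕ.+ suc (k ℕ.+ u)
    +-double = solve-∀

  -- Expansion along the last row, whose exponent is 0: only the column p meeting the face survives.
  alternant-onFace-last : ∀ {m} k (ρ : Fin (suc k) → Fin m) → Injective _≡_ _≡_ ρ → ∀ {v} p → ρ p ≡ v →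
    ∀ e → (∀ i → 1 ≤ e (Fin.inject₁ i)) → e (Fin.fromℕ k) ≡ 0 → ∀ ψ →
    alternant (suc k) ρ e (onFace v ψ) ≡ -1^ (k ℕ.+ toℕ p) · alternant k (ρ ∘ punchIn p) (e ∘ Fin.inject₁) (onFace v ψ)
  alternant-onFace-last zero ρ inj {v} zero ρp e pos e₀≡0 ψ = trans (ℚₚ.+-identityʳ _)
    (cong (onFace v ψ) (Vecₚ.updateAt-id-local (ρ zero) (Vec.replicate _ 0) (cong (ℕ._+ Vec.lookup (Vec.replicate _ 0) (ρ zero)) e₀≡0)))
  alternant-onFace-last (suc k) ρ inj {v} p ρp e pos eₙ≡0 ψ = begin
    ∑[ j < suc (suc k) ] (-1^ toℕ j · minor (suc k) ρ e (onFace v ψ) j)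
      ≡⟨ sum-remove {i = p} (λ j → -1^ toℕ j · minor (suc k) ρ e (onFace v ψ) j) ⟩
    -1^ toℕ p · minor (suc k) ρ e (onFace v ψ) p + ∑[ j < suc k ] (-1^ toℕ (punchIn p j) · minor (suc k) ρ e (onFace v ψ) (punchIn p j))
      ≡⟨ cong₂ _+_ (trans (cong (-1^ toℕ p ·_) (minor-onFace-self (suc k) ρ e ψ p ρp (pos zero))) (-1^-zero (toℕ p)))
                   (sum-cong-≗ other) ⟩
    0ℚ + ∑[ j < suc k ] (-1^ (suc k ℕ.+ toℕ p) · -1^ toℕ j · M j)
      ≡⟨ ℚₚ.+-identityˡ _ ⟩
    ∑[ j < suc k ] (-1^ (suc k ℕ.+ toℕ p) · -1^ toℕ j · M j)
      ≡⟨ sym (-1^-sum (suc k ℕ.+ toℕ p) (λ j → -1^ toℕ j · M j)) ⟩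
    -1^ (suc k ℕ.+ toℕ p) · alternant (suc k) (ρ ∘ punchIn p) (e ∘ Fin.inject₁) (onFace v ψ) ∎
    where
    M : Fin (suc k) → ℚ
    M = minor k (ρ ∘ punchIn p) (e ∘ Fin.inject₁) (onFace v ψ)
    other : ∀ j′ → -1^ toℕ (punchIn p j′) · minor (suc k) ρ e (onFace v ψ) (punchIn p j′) ≡ -1^ (suc k ℕ.+ toℕ p) · -1^ toℕ j′ · M j′
    other j′ = begin
      -1^ toℕ j · minor (suc k) ρ e (onFace v ψ) j
        ≡⟨ cong (-1^ toℕ j ·_) (minor-onFace (suc k) ρ e ψ j ρj≢v) ⟩
      -1^ toℕ j · alternant (suc k) (ρ ∘ punchIn j) (e ∘ suc) (onFace v ψ′)
        ≡⟨ cong (-1^ toℕ j ·_) (alternant-onFace-last k (ρ ∘ punchIn j) (injective-punchIn inj j) (punchOut j≢p)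
             (trans (cong ρ (Finₚ.punchIn-punchOut j≢p)) ρp) (e ∘ suc) (pos ∘ suc) eₙ≡0 ψ′) ⟩
      -1^ toℕ j · -1^ (k ℕ.+ B) · X
        ≡⟨ sym (-1^-+ (toℕ j) (k ℕ.+ B) X) ⟩
      -1^ (toℕ j ℕ.+ (k ℕ.+ B)) · X
        ≡⟨ -1^-even (toℕ j ℕ.+ (k ℕ.+ B)) (suc k ℕ.+ toℕ p ℕ.+ toℕ j′) (suc (k ℕ.+ (B ℕ.+ toℕ j′))) X parity ⟩
      -1^ (suc k ℕ.+ toℕ p ℕ.+ toℕ j′) · X
        ≡⟨ -1^-+ (suc k ℕ.+ toℕ p) (toℕ j′) X ⟩
      -1^ (suc k ℕ.+ toℕ p) · -1^ toℕ j′ · X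
        ≡⟨ cong (λ z → -1^ (suc k ℕ.+ toℕ p) · -1^ toℕ j′ · z) X≡M ⟩
      -1^ (suc k ℕ.+ toℕ p) · -1^ toℕ j′ · M j′ ∎
      where
      j = punchIn p j′
      j≢p : j ≢ p
      j≢p = Finₚ.punchInᵢ≢i p j′
      p≢j : p ≢ j
      p≢j = j≢p ∘ sym
      ρj≢v : ρ j ≢ v
      ρj≢v ρj≡v = j≢p (inj (trans ρj≡v (sym ρp)))
      ψ′ = shift (ρ j) (e zero) ψ
      B = toℕ (punchOut j≢p)
      X = alternant k (ρ ∘ punchIn j ∘ punchIn (punchOut j≢p)) (e ∘ suc ∘ Fin.inject₁) (onFace v ψ′)
      punchOut≡j′ : punchOut p≢j ≡ j′
      punchOut≡j′ = trans (Finₚ.punchOut-cong p refl) (Finₚ.punchOut-punchIn p)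
      parity : toℕ j ℕ.+ (k ℕ.+ B) ℕ.+ (suc k ℕ.+ toℕ p ℕ.+ toℕ j′) ≡ suc (k ℕ.+ (B ℕ.+ toℕ j′)) ℕ.+ suc (k ℕ.+ (B ℕ.+ toℕ j′))
      parity = begin
        toℕ j ℕ.+ (k ℕ.+ B) ℕ.+ (suc k ℕ.+ toℕ p ℕ.+ toℕ j′) ≡⟨ +-rearrange (toℕ j) k B (toℕ p) (toℕ j′) ⟩
        (toℕ j ℕ.+ toℕ p) ℕ.+ ((B ℕ.+ toℕ j′) ℕ.+ (k ℕ.+ suc k))
          ≡⟨ cong (ℕ._+ ((B ℕ.+ toℕ j′) ℕ.+ (k ℕ.+ suc k)))
               (sym (trans (cong (λ z → suc (B ℕ.+ toℕ z)) (sym punchOut≡j′)) (punchOut-+ j≢p p≢j))) ⟩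
        suc (B ℕ.+ toℕ j′) ℕ.+ ((B ℕ.+ toℕ j′) ℕ.+ (k ℕ.+ suc k)) ≡⟨ +-double k (B ℕ.+ toℕ j′) ⟩
        suc (k ℕ.+ (B ℕ.+ toℕ j′)) ℕ.+ suc (k ℕ.+ (B ℕ.+ toℕ j′)) ∎
      X≡M : X ≡ M j′
      X≡M = alternant-cong k
        (λ x → cong ρ (trans (punchIn-punchOut-swap j≢p p≢j x) (cong (λ z → punchIn p (punchIn z x)) punchOut≡j′)))
        (λ _ → refl) (λ b → sym (shift-onFace (e zero) ψ ρj≢v b))

  alternant-suc : ∀ {m} k (σ : Fin k → Fin m) e (φ : Vec ℕ (suc m) → ℚ) →
    alternant k (suc ∘ σ) e φ ≡ alternant k σ e (λ b → φ (0 ∷ b))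
  alternant-suc zero    σ e φ = refl
  alternant-suc (suc k) σ e φ = sum-cong-≗ λ j →
    cong (-1^ toℕ j ·_) (alternant-suc k (σ ∘ punchIn j) (e ∘ suc) (shift (suc (σ j)) (e zero) φ))

  boundary : ∀ n → Vec ℕ (suc n) → ℚ
  boundary n = onFace zero (intMonomial n ∘ Vec.tail)

  alternant-recursion : ∀ n (e : Fin (suc n) → ℕ) →
    ι (Vec.sum (Vec.tabulate e) ℕ.+ suc n) * alternant (suc n) id e (intMonomial (suc n)) ≡
    ∑[ i < suc n ] (ι (e i) * alternant (suc n) id (updateAt e i ℕ.pred) (intMonomial (suc n))) + alternant (suc n) id e (boundary n)
  alternant-recursion n e = begin
    ι (Vec.sum (Vec.tabulate e) ℕ.+ suc n) * A J            ≡⟨ sym (alternant-degree (suc n) id e (λ s → ι (s ℕ.+ suc n)) J) ⟩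
    A (λ b → ι (Vec.sum b ℕ.+ suc n) * J b)                 ≡⟨ sym (alternant-congᶠ (suc n) id e (∂-intMonomial n)) ⟩
    A (λ b → ∂ J b + boundary n b)                          ≡⟨ alternant-+ (suc n) id e (∂ J) (boundary n) ⟩
    A (∂ J) + A (boundary n)                                ≡⟨ cong (_+ A (boundary n)) (alternant-∂ (suc n) id e J) ⟩
    ∑[ i < suc n ] (ι (e i) * alternant (suc n) id (updateAt e i ℕ.pred) J) + A (boundary n) ∎
    where
    A = alternant (suc n) id e
    J = intMonomial (suc n)

  alternant-boundary-vanishes : ∀ n e → (∀ i → 1 ≤ e i) → alternant (suc n) id e (boundary n) ≡ 0ℚ
  alternant-boundary-vanishes n e pos = alternant-onFace-vanishes n id id zero refl e pos (intMonomial n ∘ Vec.tail)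

  alternant-boundary-last : ∀ n e → (∀ i → 1 ≤ e (Fin.inject₁ i)) → e (Fin.fromℕ n) ≡ 0 →
    alternant (suc n) id e (boundary n) ≡ -1^ n · alternant n id (e ∘ Fin.inject₁) (intMonomial n)
  alternant-boundary-last n e pos eₙ≡0 = begin
    alternant (suc n) id e (boundary n)
      ≡⟨ alternant-onFace-last n id id zero refl e pos eₙ≡0 (intMonomial n ∘ Vec.tail) ⟩
    -1^ (n ℕ.+ 0) · alternant n suc (e ∘ Fin.inject₁) (boundary n)
      ≡⟨ cong₂ -1^_·_ (ℕₚ.+-identityʳ n) (alternant-suc n id (e ∘ Fin.inject₁) (boundary n)) ⟩
    -1^ n · alternant n id (e ∘ Fin.inject₁) (intMonomial n) ∎


module ShiftedShapes where

  open import Defs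
  open import Data.Fin as Fin using (Fin; zero; suc; toℕ)
  import Data.Fin.Properties as Finₚ
  open import Data.List as List using (List; []; _∷_; _++_; length; upTo)
  import Data.List.Properties as Listₚ
  open import Data.List.Membership.Propositional using (_∈_)
  open import Data.List.Membership.Propositional.Properties using (∈-map⁺; ∈-map⁻; ∈-++⁺ˡ; ∈-++⁺ʳ; ∈-++⁻; ∈-upTo⁺; ∈-upTo⁻)
  open import Data.Nat as ℕ using (ℕ; zero; suc; _≤_; _<_; s≤s; z≤n)
  import Data.Nat.Properties as ℕₚ
  open import Data.Product using (_×_; _,_; Σ-syntax; proj₁; proj₂)
  open import Data.Sum using (_⊎_; inj₁; inj₂)
  open import Data.Unit using (⊤; tt)
  open import Data.Empty using (⊥-elim)
  open import Data.Vec as Vec using (Vec; []; _∷_; _[_]%=_)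
  import Data.Vec.Properties as Vecₚ
  open import Relation.Binary.PropositionalEquality
  open import Relation.Nullary using (¬_; Dec; yes; no)
  open import Relation.Nullary.Decidable using (_×-dec_)

  shrinkRow : ∀ {n} → Fin n → Vec ℕ n → Vec ℕ n
  shrinkRow i v = v [ i ]%= ℕ.pred

  Strict : ∀ {n} → Vec ℕ n → Set
  Strict [] = ⊤
  Strict (x ∷ []) = 1 ≤ x
  Strict (x ∷ y ∷ xs) = y < x × Strict (y ∷ xs)

  strict? : ∀ {n} (v : Vec ℕ n) → Dec (Strict v)
  strict? [] = yes tt
  strict? (x ∷ []) = 1 ℕ.≤? x
  strict? (x ∷ y ∷ xs) = (y ℕ.<? x) ×-dec strict? (y ∷ xs)

  Strict-tail : ∀ {n} x (v : Vec ℕ n) → Strict (x ∷ v) → Strict v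
  Strict-tail x [] d = tt
  Strict-tail x (y ∷ v) (_ , d) = d

  Strict⇒positive : ∀ {n} (v : Vec ℕ n) → Strict v → ∀ i → 1 ≤ Vec.lookup v i
  Strict⇒positive (x ∷ []) d zero = d
  Strict⇒positive (x ∷ y ∷ v) (lt , d) zero = ℕₚ.≤-trans (Strict⇒positive (y ∷ v) d zero) (ℕₚ.<⇒≤ lt)
  Strict⇒positive (x ∷ y ∷ v) (lt , d) (suc i) = Strict⇒positive (y ∷ v) d i

  dropLast : ∀ {n} → Vec ℕ (suc n) → Vec ℕ n
  dropLast (x ∷ []) = []
  dropLast (x ∷ y ∷ xs) = x ∷ dropLast (y ∷ xs)

  Strict-dropLast : ∀ {n} (v : Vec ℕ (suc n)) → Strict v → Strict (dropLast v)
  Strict-dropLast (x ∷ []) d = tt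
  Strict-dropLast (x ∷ y ∷ []) (lt , d) = ℕₚ.≤-trans d (ℕₚ.<⇒≤ lt)
  Strict-dropLast (x ∷ y ∷ z ∷ v) (lt , d) = lt , Strict-dropLast (y ∷ z ∷ v) d

  rowCells : ℕ → ℕ → List (ℕ × ℕ)
  rowCells s l = List.map (λ k → (s , s ℕ.+ k)) (upTo l)

  length-cellsFrom : ∀ {n} s (v : Vec ℕ n) → length (cellsFrom s v) ≡ size v
  length-cellsFrom s [] = refl
  length-cellsFrom s (l ∷ v) = trans (Listₚ.length-++ (rowCells s l))
    (cong₂ ℕ._+_ (trans (Listₚ.length-map _ (upTo l)) (Listₚ.length-upTo l)) (length-cellsFrom (suc s) v))

  ∈-cellsFrom⁻ : ∀ {n} s (v : Vec ℕ n) w → w ∈ cellsFrom s v →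
    Σ[ i ∈ Fin n ] (proj₁ w ≡ s ℕ.+ toℕ i × s ℕ.+ toℕ i ≤ proj₂ w × proj₂ w < s ℕ.+ toℕ i ℕ.+ Vec.lookup v i)
  ∈-cellsFrom⁻ s (l ∷ v) w m with ∈-++⁻ (rowCells s l) m
  ... | inj₁ m' with ∈-map⁻ (λ k → (s , s ℕ.+ k)) m'
  ...   | k , mk , refl = zero , sym (ℕₚ.+-identityʳ s) , subst (_≤ s ℕ.+ k) (sym (ℕₚ.+-identityʳ s)) (ℕₚ.m≤m+n s k) ,
            subst (λ z → s ℕ.+ k < z ℕ.+ l) (sym (ℕₚ.+-identityʳ s)) (ℕₚ.+-monoʳ-< s (∈-upTo⁻ mk))
  ∈-cellsFrom⁻ s (l ∷ v) w m | inj₂ m' with ∈-cellsFrom⁻ (suc s) v w m'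
  ... | i , e1 , e2 , e3 = suc i , trans e1 (sym (ℕₚ.+-suc s (toℕ i))) ,
          subst (_≤ proj₂ w) (sym (ℕₚ.+-suc s (toℕ i))) e2 , subst (λ z → proj₂ w < z ℕ.+ Vec.lookup v i) (sym (ℕₚ.+-suc s (toℕ i))) e3

  ∈-cellsFrom⁺ : ∀ {n} s (v : Vec ℕ n) i c → s ℕ.+ toℕ i ≤ c → c < s ℕ.+ toℕ i ℕ.+ Vec.lookup v i → (s ℕ.+ toℕ i , c) ∈ cellsFrom s v
  ∈-cellsFrom⁺ s (l ∷ v) zero c h1 h2 = ∈-++⁺ˡ (subst (λ z → (z , c) ∈ rowCells s l) (sym (ℕₚ.+-identityʳ s))
    (subst (λ z → (s , z) ∈ rowCells s l) (ℕₚ.m+[n∸m]≡n h1') (∈-map⁺ (λ k → (s , s ℕ.+ k)) (∈-upTo⁺ lt))))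
    where
    h1' : s ≤ c
    h1' = subst (_≤ c) (ℕₚ.+-identityʳ s) h1
    lt : c ℕ.∸ s < l
    lt = ℕₚ.+-cancelˡ-< s (c ℕ.∸ s) l (subst (_< s ℕ.+ l) (sym (ℕₚ.m+[n∸m]≡n h1')) (subst (λ z → c < z ℕ.+ l) (ℕₚ.+-identityʳ s) h2))
  ∈-cellsFrom⁺ s (l ∷ v) (suc i) c h1 h2 = ∈-++⁺ʳ (rowCells s l) (subst (λ z → (z , c) ∈ cellsFrom (suc s) v) (sym (ℕₚ.+-suc s (toℕ i)))
    (∈-cellsFrom⁺ (suc s) v i c (subst (_≤ c) (ℕₚ.+-suc s (toℕ i)) h1) (subst (λ z → c < z ℕ.+ Vec.lookup v i) (ℕₚ.+-suc s (toℕ i)) h2)))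

  rowCells-suc : ∀ s l → rowCells s (suc l) ≡ rowCells s l ++ (s , s ℕ.+ l) ∷ []
  rowCells-suc s l = trans (cong (List.map (λ k → (s , s ℕ.+ k))) (sym (Listₚ.upTo-∷ʳ l))) (Listₚ.map-++ _ (upTo l) (l ∷ []))

  cellsFrom-shrinkRow : ∀ {n} s (v : Vec ℕ n) (i : Fin n) l → Vec.lookup v i ≡ suc l →
    Σ[ A ∈ List (ℕ × ℕ) ] Σ[ B ∈ List (ℕ × ℕ) ]
      (cellsFrom s v ≡ A ++ (s ℕ.+ toℕ i , s ℕ.+ toℕ i ℕ.+ l) ∷ B × cellsFrom s (shrinkRow i v) ≡ A ++ B)
  cellsFrom-shrinkRow s (.(suc l) ∷ v) zero l refl = rowCells s l , cellsFrom (suc s) v ,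
    trans (cong (_++ cellsFrom (suc s) v) (rowCells-suc s l))
     (trans (Listₚ.++-assoc (rowCells s l) _ _) (cong (λ z → rowCells s l ++ (z , z ℕ.+ l) ∷ cellsFrom (suc s) v) (sym (ℕₚ.+-identityʳ s)))) ,
    refl
  cellsFrom-shrinkRow s (x ∷ v) (suc i) l eq with cellsFrom-shrinkRow (suc s) v i l eq
  ... | A , B , e1 , e2 = rowCells s x ++ A , B ,
    trans (cong (rowCells s x ++_) e1) (trans (sym (Listₚ.++-assoc (rowCells s x) A _))
      (cong (λ z → (rowCells s x ++ A) ++ (z , z ℕ.+ l) ∷ B) (sym (ℕₚ.+-suc s (toℕ i))))) ,
    trans (cong (rowCells s x ++_) e2) (sym (Listₚ.++-assoc (rowCells s x) A B))

  cellsFrom-dropLast : ∀ {n} s (v : Vec ℕ (suc n)) → Vec.lookup v (Fin.fromℕ n) ≡ 1 →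
    cellsFrom s v ≡ cellsFrom s (dropLast v) ++ (s ℕ.+ n , s ℕ.+ n ℕ.+ 0) ∷ []
  cellsFrom-dropLast s (.1 ∷ []) refl = cong (λ z → (z , z ℕ.+ 0) ∷ []) (sym (ℕₚ.+-identityʳ s))
  cellsFrom-dropLast {suc n} s (x ∷ y ∷ v) eq = trans (cong (rowCells s x ++_) (cellsFrom-dropLast (suc s) (y ∷ v) eq))
    (trans (sym (Listₚ.++-assoc (rowCells s x) _ _))
      (cong (λ z → (rowCells s x ++ cellsFrom (suc s) (dropLast (y ∷ v))) ++ (z , z ℕ.+ 0) ∷ []) (sym (ℕₚ.+-suc s n))))

  row< : ∀ {n} s (v : Vec ℕ n) w → w ∈ cellsFrom s v → proj₁ w < s ℕ.+ n
  row< s v w m with ∈-cellsFrom⁻ s v w m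
  ... | i , e1 , _ = subst (_< s ℕ.+ _) (sym e1) (ℕₚ.+-monoʳ-< s (Finₚ.toℕ<n i))

  col< : ∀ {n} s l (v : Vec ℕ n) → Strict (l ∷ v) → ∀ w → w ∈ cellsFrom s (l ∷ v) → proj₂ w < s ℕ.+ l
  col< s l v d w m with ∈-++⁻ (rowCells s l) m
  ... | inj₁ m' with ∈-map⁻ (λ k → (s , s ℕ.+ k)) m'
  ...   | k , mk , refl = ℕₚ.+-monoʳ-< s (∈-upTo⁻ mk)
  col< s l (l₁ ∷ v) (lt , d) w m | inj₂ m' =
    ℕₚ.<-≤-trans (col< (suc s) l₁ v d w m') (subst (_≤ s ℕ.+ l) (ℕₚ.+-suc s l₁) (ℕₚ.+-monoʳ-≤ s lt))

  shrinkRow-below : ∀ {n} s (v : Vec ℕ n) (i : Fin n) l → Vec.lookup v i ≡ suc l → Strict (shrinkRow i v) →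
    ∀ w → w ∈ cellsFrom s (shrinkRow i v) → s ℕ.+ toℕ i ≤ proj₁ w → proj₂ w < s ℕ.+ toℕ i ℕ.+ l
  shrinkRow-below s (.(suc l) ∷ v) zero l refl d w m h with ∈-++⁻ (rowCells s l) m
  ... | inj₁ m' with ∈-map⁻ (λ k → (s , s ℕ.+ k)) m'
  ...   | k , mk , refl = subst (λ z → s ℕ.+ k < z ℕ.+ l) (sym (ℕₚ.+-identityʳ s)) (ℕₚ.+-monoʳ-< s (∈-upTo⁻ mk))
  shrinkRow-below s (.(suc l) ∷ l₁ ∷ v) zero l refl (lt , d) w m h | inj₂ m' =
    subst (λ z → proj₂ w < z ℕ.+ l) (sym (ℕₚ.+-identityʳ s))
      (ℕₚ.<-≤-trans (col< (suc s) l₁ v d w m') (subst (_≤ s ℕ.+ l) (ℕₚ.+-suc s l₁) (ℕₚ.+-monoʳ-≤ s lt)))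
  shrinkRow-below s (x ∷ v) (suc i) l eq d w m h with ∈-++⁻ (rowCells s x) m
  ... | inj₁ m' with ∈-map⁻ (λ k → (s , s ℕ.+ k)) m'
  ...   | k , mk , refl = ⊥-elim (ℕₚ.<-irrefl refl (ℕₚ.<-≤-trans (ℕₚ.m<m+n s {suc (toℕ i)} (s≤s z≤n)) h))
  shrinkRow-below s (x ∷ v) (suc i) l eq d w m h | inj₂ m' =
    subst (λ z → proj₂ w < z ℕ.+ l) (sym (ℕₚ.+-suc s (toℕ i)))
      (shrinkRow-below (suc s) v i l eq (Strict-tail x (shrinkRow i v) d) w m' (subst (_≤ proj₁ w) (ℕₚ.+-suc s (toℕ i)) h))

  size-shrinkRow : ∀ {n} (v : Vec ℕ n) (i : Fin n) l → Vec.lookup v i ≡ suc l → suc (size (shrinkRow i v)) ≡ size v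
  size-shrinkRow (.(suc l) ∷ v) zero l refl = refl
  size-shrinkRow (x ∷ v) (suc i) l eq = trans (sym (ℕₚ.+-suc x _)) (cong (x ℕ.+_) (size-shrinkRow v i l eq))

  size-dropLast : ∀ {n} (v : Vec ℕ (suc n)) → Vec.lookup v (Fin.fromℕ n) ≡ 1 → suc (size (dropLast v)) ≡ size v
  size-dropLast (.1 ∷ []) refl = refl
  size-dropLast {suc n} (x ∷ y ∷ v) eq = trans (sym (ℕₚ.+-suc x _)) (cong (x ℕ.+_) (size-dropLast (y ∷ v) eq))

  length-one⇒last : ∀ {n} (v : Vec ℕ n) → Strict v → ∀ i → Vec.lookup v i ≡ 1 → suc (toℕ i) ≡ n
  length-one⇒last (x ∷ []) d zero eq = refl
  length-one⇒last (x ∷ y ∷ v) (lt , d) zero eq = ⊥-elim (ℕₚ.<-irrefl refl (ℕₚ.<-≤-trans (subst (_ <_) eq lt) (Strict⇒positive (y ∷ v) d zero)))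
  length-one⇒last (x ∷ y ∷ v) (lt , d) (suc i) eq = cong suc (length-one⇒last (y ∷ v) d i eq)

  ¬Strict-shrinkRow : ∀ {n} (v : Vec ℕ (suc n)) → Strict v → ∀ i l → Vec.lookup v i ≡ suc (suc l) → ¬ Strict (shrinkRow i v) →
    Σ[ j ∈ Fin n ] (Fin.inject₁ j ≡ i × Vec.lookup v (suc j) ≡ suc l)
  ¬Strict-shrinkRow (.(suc (suc l)) ∷ []) d zero l refl nd = ⊥-elim (nd (s≤s z≤n))
  ¬Strict-shrinkRow (.(suc (suc l)) ∷ y ∷ v) (lt , d) zero l refl nd with y ℕ.<? suc l
  ... | yes lt' = ⊥-elim (nd (lt' , d))
  ... | no nlt = zero , refl , ℕₚ.≤-antisym (ℕₚ.≤-pred lt) (ℕₚ.≮⇒≥ nlt)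
  ¬Strict-shrinkRow (x ∷ y ∷ v) (lt , d) (suc i) l eq nd with strict? (shrinkRow i (y ∷ v))
  ... | no nd' with ¬Strict-shrinkRow (y ∷ v) d i l eq nd'
  ...   | j , e1 , e2 = suc j , cong suc e1 , e2
  ¬Strict-shrinkRow (x ∷ y ∷ v) (lt , d) (suc zero) l eq nd | yes d' = ⊥-elim (nd (ℕₚ.≤-<-trans (ℕₚ.pred[n]≤n {y}) lt , d'))
  ¬Strict-shrinkRow (x ∷ y ∷ v) (lt , d) (suc (suc i)) l eq nd | yes d' = ⊥-elim (nd (lt , d'))

  corner-kind : ∀ {n} (v : Vec ℕ (suc n)) → Strict v → (i : Fin (suc n)) (l : ℕ) → Vec.lookup v i ≡ suc l →
    ¬ ((suc (toℕ i) , toℕ i ℕ.+ l) ∈ cells v) → Strict (shrinkRow i v) ⊎ (l ≡ 0 × suc (toℕ i) ≡ suc n)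
  corner-kind v d i l eqi nd with strict? (shrinkRow i v)
  ... | yes d' = inj₁ d'
  ... | no nd' with l
  ...   | zero = inj₂ (refl , length-one⇒last v d i eqi)
  ...   | suc l'' with ¬Strict-shrinkRow v d i l'' eqi nd'
  ...     | j , e1 , e2' = ⊥-elim (nd (subst (λ z → (z , c) ∈ cells v) t2 (∈-cellsFrom⁺ 0 v i2 c h1 h2)))
      where
      i2 = suc j
      t2 : toℕ i2 ≡ suc (toℕ i)
      t2 = cong suc (trans (sym (Finₚ.toℕ-inject₁ j)) (cong toℕ e1))
      c = toℕ i ℕ.+ suc l''
      h0 : suc (toℕ i) ≤ toℕ i ℕ.+ suc l''
      h0 = subst (_≤ toℕ i ℕ.+ suc l'') (ℕₚ.+-comm (toℕ i) 1) (ℕₚ.+-monoʳ-≤ (toℕ i) (s≤s z≤n))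
      h1 : toℕ i2 ≤ c
      h1 = subst (_≤ c) (sym t2) h0
      h2' : c < suc (toℕ i) ℕ.+ suc l''
      h2' = s≤s ℕₚ.≤-refl
      h2 : c < toℕ i2 ℕ.+ Vec.lookup v i2
      h2 = subst (c <_) (cong₂ ℕ._+_ (sym t2) (sym e2')) h2'

  corner-classification : ∀ {n} (v : Vec ℕ (suc n)) → Strict v → ∀ w → w ∈ cells v →
    ¬ ((proj₁ w , suc (proj₂ w)) ∈ cells v) → ¬ ((suc (proj₁ w) , proj₂ w) ∈ cells v) →
    Σ[ i ∈ Fin (suc n) ] Σ[ l ∈ ℕ ] (Vec.lookup v i ≡ suc l × w ≡ (toℕ i , toℕ i ℕ.+ l) ×
      (Strict (shrinkRow i v) ⊎ (l ≡ 0 × suc (toℕ i) ≡ suc n)))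
  corner-classification v d (r , c) m nr nd with ∈-cellsFrom⁻ 0 v (r , c) m
  ... | i , refl , e2 , e3 with Vec.lookup v i in eqi | Strict⇒positive v d i
  ...   | suc l | _ = i , l , eqi , cong (toℕ i ,_) ceq , corner-kind v d i l eqi (λ m' → nd (subst (λ z → (suc (toℕ i) , z) ∈ cells v) (sym ceq) m'))
    where
    ceq : c ≡ toℕ i ℕ.+ l
    ceq with ℕₚ.m≤n⇒m<n∨m≡n (ℕₚ.≤-pred (subst (c <_) (ℕₚ.+-suc (toℕ i) l) e3))
    ... | inj₂ e = e
    ... | inj₁ lt = ⊥-elim (nr (∈-cellsFrom⁺ 0 v i (suc c) (ℕₚ.m≤n⇒m≤1+n e2)
                       (subst (suc c <_) (trans (sym (ℕₚ.+-suc (toℕ i) l)) (cong (toℕ i ℕ.+_) (sym eqi))) (s≤s lt))))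


  last≤ : ∀ {n} (v : Vec ℕ (suc n)) → Strict v → ∀ i → Vec.lookup v (Fin.fromℕ n) ≤ Vec.lookup v i
  last≤ (x ∷ [])    d        zero    = ℕₚ.≤-refl
  last≤ (x ∷ y ∷ v) (lt , d) zero    = ℕₚ.≤-trans (last≤ (y ∷ v) d zero) (ℕₚ.<⇒≤ lt)
  last≤ (x ∷ y ∷ v) (lt , d) (suc i) = last≤ (y ∷ v) d i

  last< : ∀ {n} (v : Vec ℕ (suc n)) → Strict v → ∀ (j : Fin n) → Vec.lookup v (Fin.fromℕ n) < Vec.lookup v (Fin.inject₁ j)
  last< (x ∷ y ∷ v) (lt , d) zero    = ℕₚ.≤-<-trans (last≤ (y ∷ v) d zero) lt
  last< (x ∷ y ∷ v) (lt , d) (suc j) = last< (y ∷ v) d j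

  corner-length : ∀ {n} (v : Vec ℕ n) i l → Vec.lookup v i ≡ suc l → Strict (shrinkRow i v) → Σ[ l′ ∈ ℕ ] l ≡ suc l′
  corner-length v i zero    eq d′ = ⊥-elim (ℕₚ.<-irrefl refl (ℕₚ.<-≤-trans (s≤s z≤n)
    (subst (1 ≤_) (trans (Vecₚ.lookup∘updateAt i v) (cong ℕ.pred eq)) (Strict⇒positive (shrinkRow i v) d′ i))))
  corner-length v i (suc l) eq d′ = l , refl

  StrictPartition⇒Strict : ∀ {n} (v : Vec ℕ n) → StrictPartition v → Strict v
  StrictPartition⇒Strict []          sp          = tt
  StrictPartition⇒Strict (x ∷ [])     (pos , dec) = pos zero
  StrictPartition⇒Strict (x ∷ y ∷ v) (pos , dec) = dec zero (suc zero) (s≤s z≤n) ,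
    StrictPartition⇒Strict (y ∷ v) ((λ i → pos (suc i)) , λ i j lt → dec (suc i) (suc j) (s≤s lt))


module IntegralRecursion where

  open import Defs
  open Alternants
  open ShiftedShapes
  open import Data.Empty using (⊥-elim)
  open import Data.Fin as Fin using (Fin; zero; suc; toℕ)
  import Data.Fin.Properties as Finₚ
  open import Data.Integer using () renaming (+_ to +ℤ_)
  open import Data.Nat as ℕ using (ℕ; zero; suc; _≤_; _<_; s≤s; z≤n; _!)
  import Data.Nat.DivMod as ℕ
  open import Data.Nat.Divisibility using (divides)
  import Data.Nat.Properties as ℕₚ
  open import Data.Nat.Tactic.RingSolver using (solve-∀)
  open import Data.Product using (_,_)
  open import Data.Rational using (ℚ; 0ℚ; _+_; _*_; _/_)
  import Data.Rational.Properties as ℚₚ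
  open import Data.Rational.Solver using (module +-*-Solver)
  open import Data.Vec as Vec using (Vec; []; _∷_)
  import Data.Vec.Properties as Vecₚ
  open import Data.Vec.Functional using (updateAt)
  import Data.Vec.Functional.Properties as VFₚ
  open import Function using (_∘_; id)
  open import Relation.Binary.PropositionalEquality using (_≡_; _≢_; refl; sym; trans; cong; cong₂; subst; module ≡-Reasoning)
  open import Relation.Nullary using (¬_)

  open ≡-Reasoning
  open +-*-Solver

  private
    *-rearrange : ∀ a f l → a ℕ.* (f ℕ.* l) ≡ l ℕ.* a ℕ.* f
    *-rearrange = solve-∀

  exponents : ∀ {n} → Vec ℕ n → Fin n → ℕ
  exponents v = Vec.lookup (minusOnes v)

  prefactor : ∀ {n} → Vec ℕ n → ℚ
  prefactor v = (+ℤ (size v !) / factProd (minusOnes v)) {{factProd≢0 (minusOnes v)}}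

  triangle : ℕ → ℕ
  triangle n = (n ℕ.* (n ℕ.∸ 1)) ℕ./ 2

  triangle-suc : ∀ n → triangle (suc n) ≡ triangle n ℕ.+ n
  triangle-suc zero    = refl
  triangle-suc (suc m) = begin
    (suc (suc m) ℕ.* suc m) ℕ./ 2               ≡⟨ cong (ℕ._/ 2) (expand m) ⟩
    (suc m ℕ.* m ℕ.+ suc m ℕ.* 2) ℕ./ 2         ≡⟨ ℕ.+-distrib-/-∣ʳ (suc m ℕ.* m) {suc m ℕ.* 2} {2} (divides (suc m) refl) ⟩
    (suc m ℕ.* m) ℕ./ 2 ℕ.+ (suc m ℕ.* 2) ℕ./ 2 ≡⟨ cong ((suc m ℕ.* m) ℕ./ 2 ℕ.+_) (ℕ.m*n/n≡m (suc m) 2) ⟩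
    triangle (suc m) ℕ.+ suc m                  ∎
    where
    expand : ∀ m → suc (suc m) ℕ.* suc m ≡ suc m ℕ.* m ℕ.+ suc m ℕ.* 2
    expand = solve-∀

  rhs≡alternant : ∀ {n} (v : Vec ℕ n) →
    rhs v ≡ prefactor v * -1^ triangle n · alternant n id (exponents v) (intMonomial n)
  rhs≡alternant {n} v = cong (prefactor v *_) (begin
    integralSimplex (abarPoly (minusOnes v))                          ≡⟨ integralSimplex≡eval (abarPoly (minusOnes v)) ⟩
    eval (intMonomial n) (signP (triangle n) (aPoly (minusOnes v)))   ≡⟨ eval-signP (intMonomial n) (triangle n) (aPoly (minusOnes v)) ⟩
    -1^ triangle n · eval (intMonomial n) (aPoly (minusOnes v))       ≡⟨ cong (-1^ triangle n ·_) (eval-det n id (exponents v) (intMonomial n)) ⟩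
    -1^ triangle n · alternant n id (exponents v) (intMonomial n)     ∎)

  exponents-shrinkRow : ∀ {n} (v : Vec ℕ n) i j → exponents (shrinkRow i v) j ≡ updateAt (exponents v) i ℕ.pred j
  exponents-shrinkRow (x ∷ v) zero    zero    = pred-∸ x
    where
    pred-∸ : ∀ x → ℕ.pred x ℕ.∸ 1 ≡ ℕ.pred (x ℕ.∸ 1)
    pred-∸ zero    = refl
    pred-∸ (suc x) = refl
  exponents-shrinkRow (x ∷ v) zero    (suc j) = refl
  exponents-shrinkRow (x ∷ v) (suc i) zero    = refl
  exponents-shrinkRow (x ∷ v) (suc i) (suc j) = exponents-shrinkRow v i j

  exponents-dropLast : ∀ {n} (v : Vec ℕ (suc n)) j → exponents (dropLast v) j ≡ exponents v (Fin.inject₁ j)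
  exponents-dropLast (x ∷ y ∷ v) zero    = refl
  exponents-dropLast (x ∷ y ∷ v) (suc j) = exponents-dropLast (y ∷ v) j

  exponents-lookup : ∀ {n} (v : Vec ℕ n) i → exponents v i ≡ Vec.lookup v i ℕ.∸ 1
  exponents-lookup v i = Vecₚ.lookup-map i (ℕ._∸ 1) v

  factProd-shrinkRow : ∀ {n} (v : Vec ℕ n) i l → Vec.lookup v i ≡ suc (suc l) →
    factProd (minusOnes v) ≡ factProd (minusOnes (shrinkRow i v)) ℕ.* suc l
  factProd-shrinkRow (.(suc (suc l)) ∷ v) zero l refl = begin
    suc l ! ℕ.* factProd (minusOnes v)                ≡⟨ ℕₚ.*-assoc (suc l) (l !) _ ⟩
    suc l ℕ.* (l ! ℕ.* factProd (minusOnes v))        ≡⟨ ℕₚ.*-comm (suc l) _ ⟩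
    l ! ℕ.* factProd (minusOnes v) ℕ.* suc l          ∎
  factProd-shrinkRow (x ∷ v) (suc i) l eq = trans (cong ((x ℕ.∸ 1) ! ℕ.*_) (factProd-shrinkRow v i l eq))
    (sym (ℕₚ.*-assoc ((x ℕ.∸ 1) !) _ (suc l)))

  factProd-dropLast : ∀ {n} (v : Vec ℕ (suc n)) → Vec.lookup v (Fin.fromℕ n) ≡ 1 →
    factProd (minusOnes v) ≡ factProd (minusOnes (dropLast v))
  factProd-dropLast (.1 ∷ [])   refl = refl
  factProd-dropLast {suc n} (x ∷ y ∷ v) eq = cong ((x ℕ.∸ 1) ! ℕ.*_) (factProd-dropLast (y ∷ v) eq)

  sum-exponents : ∀ {n} (v : Vec ℕ n) → (∀ i → 1 ≤ Vec.lookup v i) →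
    Vec.sum (Vec.tabulate (exponents v)) ℕ.+ n ≡ size v
  sum-exponents []              pos = refl
  sum-exponents {suc n} (x ∷ v) pos = begin
    (x ℕ.∸ 1) ℕ.+ Vec.sum (Vec.tabulate (exponents v)) ℕ.+ suc n   ≡⟨ ℕₚ.+-suc _ n ⟩
    suc ((x ℕ.∸ 1) ℕ.+ Vec.sum (Vec.tabulate (exponents v)) ℕ.+ n) ≡⟨ cong suc (ℕₚ.+-assoc (x ℕ.∸ 1) _ n) ⟩
    suc ((x ℕ.∸ 1) ℕ.+ (Vec.sum (Vec.tabulate (exponents v)) ℕ.+ n)) ≡⟨ cong (λ z → suc ((x ℕ.∸ 1) ℕ.+ z)) (sum-exponents v (pos ∘ suc)) ⟩
    suc ((x ℕ.∸ 1) ℕ.+ size v)                                       ≡⟨ cong (ℕ._+ size v) (ℕₚ.m+[n∸m]≡n (pos zero)) ⟩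
    x ℕ.+ size v                                                     ∎

  module CornerTerms {n} (v : Vec ℕ (suc n)) (strict : Strict v) (K : ℕ) (size≡ : size v ≡ suc K) where

    private
      e = exponents v
      J = intMonomial (suc n)
      s = triangle (suc n)
      F = factProd (minusOnes v)
      instance F≢0 = factProd≢0 (minusOnes v)

    C : ℚ
    C = +ℤ (K !) / F

    term : Fin (suc n) → ℚ
    term i = C * -1^ s · (ι (e i) * alternant (suc n) id (updateAt e i ℕ.pred) J)

    boundaryTerm : ℚ
    boundaryTerm = C * -1^ s · alternant (suc n) id e (boundary n)

    prefactor≡ : prefactor v ≡ ι (suc K) * C
    prefactor≡ = trans (cong (λ z → +ℤ (z !) / F) size≡) (sym (ι-*-/ (suc K) (K !) F))

    rhs-recursion : rhs v ≡ ∑[ i < suc n ] term i + boundaryTerm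
    rhs-recursion = begin
      rhs v                                                   ≡⟨ rhs≡alternant v ⟩
      prefactor v * -1^ s · A                                 ≡⟨ cong (λ z → z * -1^ s · A) prefactor≡ ⟩
      (ι (suc K) * C) * -1^ s · A                             ≡⟨ solve 3 (λ k c a → (k :* c) :* a := c :* (k :* a)) refl (ι (suc K)) C (-1^ s · A) ⟩
      C * (ι (suc K) * -1^ s · A)                             ≡⟨ cong (C *_) (sym (-1^-*-comm s (ι (suc K)) A)) ⟩
      C * -1^ s · (ι (suc K) * A)
        ≡⟨ cong (λ z → C * -1^ s · (ι z * A)) (sym (trans (sum-exponents v (Strict⇒positive v strict)) size≡)) ⟩
      C * -1^ s · (ι (Vec.sum (Vec.tabulate e) ℕ.+ suc n) * A) ≡⟨ cong (λ z → C * -1^ s · z) (alternant-recursion n e) ⟩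
      C * -1^ s · (X + B)                                     ≡⟨ cong (C *_) (-1^-distrib-+ s X B) ⟩
      C * (-1^ s · X + -1^ s · B)                             ≡⟨ ℚₚ.*-distribˡ-+ C (-1^ s · X) (-1^ s · B) ⟩
      C * -1^ s · X + boundaryTerm                            ≡⟨ cong (λ z → C * z + boundaryTerm) (-1^-sum s (λ i → ι (e i) * Aᵢ i)) ⟩
      C * ∑[ i < suc n ] (-1^ s · (ι (e i) * Aᵢ i)) + boundaryTerm ≡⟨ cong (_+ boundaryTerm) (*-distribˡ-sum C (λ i → -1^ s · (ι (e i) * Aᵢ i))) ⟩
      ∑[ i < suc n ] term i + boundaryTerm                    ∎
      where
      A = alternant (suc n) id e J
      Aᵢ : Fin (suc n) → ℚ
      Aᵢ i = alternant (suc n) id (updateAt e i ℕ.pred) J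
      X = ∑[ i < suc n ] (ι (e i) * Aᵢ i)
      B = alternant (suc n) id e (boundary n)

    private
      term-vanishes : ∀ i → ι (e i) * alternant (suc n) id (updateAt e i ℕ.pred) J ≡ 0ℚ → term i ≡ 0ℚ
      term-vanishes i summand≡0 =
        trans (cong (λ z → C * -1^ s · z) summand≡0) (trans (cong (C *_) (-1^-zero s)) (ℚₚ.*-zeroʳ C))

    term-corner : ∀ i → Strict (shrinkRow i v) → rhs (shrinkRow i v) ≡ term i
    term-corner i strict′ with Vec.lookup v i in vᵢ≡ | Strict⇒positive v strict i
    ... | suc l | _ with corner-length v i l vᵢ≡ strict′
    ... | l′ , refl = begin
      rhs (shrinkRow i v)
        ≡⟨ rhs≡alternant (shrinkRow i v) ⟩
      prefactor (shrinkRow i v) * -1^ s · alternant (suc n) id (exponents (shrinkRow i v)) J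
        ≡⟨ cong₂ (λ a b → a * -1^ s · b) prefactor′≡ (alternant-congᵉ (suc n) id J (exponents-shrinkRow v i)) ⟩
      (ι (e i) * C) * -1^ s · Aᵢ
        ≡⟨ solve 3 (λ x c a → (x :* c) :* a := c :* (x :* a)) refl (ι (e i)) C (-1^ s · Aᵢ) ⟩
      C * (ι (e i) * -1^ s · Aᵢ)
        ≡⟨ cong (C *_) (sym (-1^-*-comm s (ι (e i)) Aᵢ)) ⟩
      term i ∎
      where
      Aᵢ = alternant (suc n) id (updateAt e i ℕ.pred) J
      F′ = factProd (minusOnes (shrinkRow i v))
      instance F′≢0 = factProd≢0 (minusOnes (shrinkRow i v))
      eᵢ≡ : e i ≡ suc l′
      eᵢ≡ = trans (exponents-lookup v i) (cong (ℕ._∸ 1) vᵢ≡)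
      size′ : size (shrinkRow i v) ≡ K
      size′ = ℕₚ.suc-injective (trans (size-shrinkRow v i (suc l′) vᵢ≡) size≡)
      cross : K ! ℕ.* F ≡ e i ℕ.* K ! ℕ.* F′
      cross = begin
        K ! ℕ.* F                 ≡⟨ cong (K ! ℕ.*_) (factProd-shrinkRow v i l′ vᵢ≡) ⟩
        K ! ℕ.* (F′ ℕ.* suc l′)   ≡⟨ *-rearrange (K !) F′ (suc l′) ⟩
        suc l′ ℕ.* K ! ℕ.* F′     ≡⟨ cong (λ z → z ℕ.* K ! ℕ.* F′) (sym eᵢ≡) ⟩
        e i ℕ.* K ! ℕ.* F′        ∎
      prefactor′≡ : prefactor (shrinkRow i v) ≡ ι (e i) * C
      prefactor′≡ = begin
        +ℤ (size (shrinkRow i v) !) / F′ ≡⟨ cong (λ z → +ℤ (z !) / F′) size′ ⟩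
        +ℤ (K !) / F′                    ≡⟨ /-cancel (K !) (e i ℕ.* K !) F′ F cross ⟩
        +ℤ (e i ℕ.* K !) / F             ≡⟨ sym (ι-*-/ (e i) (K !) F) ⟩
        ι (e i) * C                      ∎

    term-noncorner : ∀ i → ¬ Strict (shrinkRow i v) → term i ≡ 0ℚ
    term-noncorner i ¬strict′ with Vec.lookup v i in vᵢ≡ | Strict⇒positive v strict i
    ... | suc zero | _ = term-vanishes i
      (trans (cong (λ z → ι z * alternant (suc n) id (updateAt e i ℕ.pred) J) (trans (exponents-lookup v i) (cong (ℕ._∸ 1) vᵢ≡)))
                                                 (ℚₚ.*-zeroˡ (alternant (suc n) id (updateAt e i ℕ.pred) J)))
    ... | suc (suc l) | _ with ¬Strict-shrinkRow v strict i l vᵢ≡ ¬strict′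
    ... | j , refl , v₍j+1₎≡ = term-vanishes (Fin.inject₁ j)
      (trans (cong (ι (e (Fin.inject₁ j)) *_) (alternant-equal-rows n id (updateAt e (Fin.inject₁ j) ℕ.pred) j equal J))
             (ℚₚ.*-zeroʳ (ι (e (Fin.inject₁ j)))))
      where
      equal : updateAt e (Fin.inject₁ j) ℕ.pred (Fin.inject₁ j) ≡ updateAt e (Fin.inject₁ j) ℕ.pred (suc j)
      equal = begin
        updateAt e (Fin.inject₁ j) ℕ.pred (Fin.inject₁ j) ≡⟨ VFₚ.updateAt-updates (Fin.inject₁ j) e ⟩
        ℕ.pred (e (Fin.inject₁ j))                        ≡⟨ cong ℕ.pred (trans (exponents-lookup v _) (cong (ℕ._∸ 1) vᵢ≡)) ⟩
        suc l ℕ.∸ 1                                       ≡⟨ sym (trans (exponents-lookup v (suc j)) (cong (ℕ._∸ 1) v₍j+1₎≡)) ⟩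
        e (suc j)                                         ≡⟨ sym (VFₚ.updateAt-minimal (suc j) (Fin.inject₁ j) e suc≢inject₁) ⟩
        updateAt e (Fin.inject₁ j) ℕ.pred (suc j)         ∎
        where
        suc≢inject₁ : suc j ≢ Fin.inject₁ j
        suc≢inject₁ eq = ℕₚ.1+n≢n (trans (cong toℕ eq) (Finₚ.toℕ-inject₁ j))

    boundaryTerm-last : Vec.lookup v (Fin.fromℕ n) ≡ 1 → rhs (dropLast v) ≡ boundaryTerm
    boundaryTerm-last last≡1 = begin
      rhs (dropLast v)
        ≡⟨ rhs≡alternant (dropLast v) ⟩
      prefactor (dropLast v) * -1^ triangle n · alternant n id (exponents (dropLast v)) (intMonomial n)
        ≡⟨ cong₂ (λ a b → a * -1^ triangle n · b) prefactor″≡ (alternant-congᵉ n id (intMonomial n) (exponents-dropLast v)) ⟩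
      C * -1^ triangle n · Y
        ≡⟨ cong (C *_) sign≡ ⟩
      C * -1^ s · -1^ n · Y
        ≡⟨ cong (λ z → C * -1^ s · z) (sym (alternant-boundary-last n e pos eₙ≡0)) ⟩
      boundaryTerm ∎
      where
      Y = alternant n id (e ∘ Fin.inject₁) (intMonomial n)
      F″ = factProd (minusOnes (dropLast v))
      instance F″≢0 = factProd≢0 (minusOnes (dropLast v))
      size″ : size (dropLast v) ≡ K
      size″ = ℕₚ.suc-injective (trans (size-dropLast v last≡1) size≡)
      prefactor″≡ : prefactor (dropLast v) ≡ C
      prefactor″≡ = trans (cong (λ z → +ℤ (z !) / F″) size″)
        (/-cancel (K !) (K !) F″ F (cong (K ! ℕ.*_) (factProd-dropLast v last≡1)))
      sign≡ : -1^ triangle n · Y ≡ -1^ s · -1^ n · Y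
      sign≡ = sym (begin
        -1^ s · -1^ n · Y                   ≡⟨ cong (λ t → -1^ t · -1^ n · Y) (triangle-suc n) ⟩
        -1^ (triangle n ℕ.+ n) · -1^ n · Y  ≡⟨ -1^-+ (triangle n) n _ ⟩
        -1^ triangle n · -1^ n · -1^ n · Y  ≡⟨ cong (-1^ triangle n ·_) (-1^-involutive n Y) ⟩
        -1^ triangle n · Y                  ∎)
      pos : ∀ j → 1 ≤ e (Fin.inject₁ j)
      pos j = subst (1 ≤_) (sym (exponents-lookup v (Fin.inject₁ j)))
        (ℕₚ.∸-monoˡ-≤ 1 (subst (_< Vec.lookup v (Fin.inject₁ j)) last≡1 (last< v strict j)))
      eₙ≡0 : e (Fin.fromℕ n) ≡ 0
      eₙ≡0 = trans (exponents-lookup v (Fin.fromℕ n)) (cong (ℕ._∸ 1) last≡1)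

    boundaryTerm-vanishes : Vec.lookup v (Fin.fromℕ n) ≢ 1 → boundaryTerm ≡ 0ℚ
    boundaryTerm-vanishes last≢1 = trans (cong (λ z → C * -1^ s · z) (alternant-boundary-vanishes n e pos))
      (trans (cong (C *_) (-1^-zero s)) (ℚₚ.*-zeroʳ C))
      where
      2≤last : 2 ≤ Vec.lookup v (Fin.fromℕ n)
      2≤last with Vec.lookup v (Fin.fromℕ n) | Strict⇒positive v strict (Fin.fromℕ n)
      ... | suc zero    | _ = ⊥-elim (last≢1 refl)
      ... | suc (suc _) | _ = s≤s (s≤s z≤n)
      pos : ∀ i → 1 ≤ e i
      pos i = subst (1 ≤_) (sym (exponents-lookup v i)) (ℕₚ.∸-monoˡ-≤ 1 (ℕₚ.≤-trans 2≤last (last≤ v strict i)))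


module TableauRecursion where

  open import Defs
  open Alternants
  open ShiftedShapes
  open IntegralRecursion
  open import Data.Empty using (⊥; ⊥-elim)
  open import Data.Fin as Fin using (Fin; zero; suc; toℕ)
  import Data.Fin.Properties as Finₚ
  open import Data.List as List using (List; []; _∷_; _++_; length)
  import Data.List.Properties as Listₚ
  open import Data.List.Membership.Propositional using (_∈_)
  open import Data.List.Membership.Propositional.Properties using (∈-map⁺; ∈-map⁻; ∈-++⁺ˡ; ∈-++⁺ʳ; ∈-++⁻; ∈-lookup)
  open import Data.List.Relation.Unary.AllPairs using ([])
  import Data.List.Relation.Unary.Any as Any
  import Data.List.Relation.Unary.Any.Properties as Anyₚ
  open import Data.List.Relation.Unary.Unique.Propositional using (Unique)
  import Data.List.Relation.Unary.Unique.Propositional.Properties as Uniqueₚ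
  open import Data.Nat as ℕ using (ℕ; zero; suc; _≤_; _<_; s≤s; z≤n)
  import Data.Nat.Properties as ℕₚ
  open import Data.Product using (_×_; _,_; Σ-syntax; proj₁; proj₂)
  open import Data.Rational using (ℚ; 0ℚ; _+_)
  open import Data.Sum using (_⊎_; inj₁; inj₂)
  open import Data.Vec as Vec using (Vec; []; _∷_)
  open import Function using (_∘_)
  open import Function.Bundles using (_⇔_; mk⇔; Equivalence)
  open import Relation.Binary.PropositionalEquality
  open import Relation.Nullary using (¬_; yes; no)

  Square = ℕ × ℕ

  IsStandard : (xs : List Square) → ℕ → Vec ℕ (length xs) → Set
  IsStandard xs K t =
    ((p : Fin (length xs)) → 1 ≤ Vec.lookup t p × Vec.lookup t p ≤ K) ×
    ((p q : Fin (length xs)) → Vec.lookup t p ≡ Vec.lookup t q → p ≡ q) ×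
    ((p q : Fin (length xs)) → proj₁ (List.lookup xs p) ≡ proj₁ (List.lookup xs q) →
        proj₂ (List.lookup xs p) < proj₂ (List.lookup xs q) → Vec.lookup t p < Vec.lookup t q) ×
    ((p q : Fin (length xs)) → proj₂ (List.lookup xs p) ≡ proj₂ (List.lookup xs q) →
        proj₁ (List.lookup xs p) < proj₁ (List.lookup xs q) → Vec.lookup t p < Vec.lookup t q)

  module _ {z : Square} {B : List Square} where
    slot : ∀ (A : List Square) → Fin (length (A ++ z ∷ B))
    slot [] = zero
    slot (a ∷ A) = suc (slot A)

    skip : ∀ (A : List Square) → Fin (length (A ++ B)) → Fin (length (A ++ z ∷ B))
    skip [] q = suc q
    skip (a ∷ A) zero = zero
    skip (a ∷ A) (suc q) = suc (skip A q)

    insertAt : ∀ (A : List Square) → ℕ → Vec ℕ (length (A ++ B)) → Vec ℕ (length (A ++ z ∷ B))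
    insertAt [] K t = K ∷ t
    insertAt (a ∷ A) K (x ∷ t) = x ∷ insertAt A K t

    removeAt : ∀ (A : List Square) → Vec ℕ (length (A ++ z ∷ B)) → Vec ℕ (length (A ++ B))
    removeAt [] (x ∷ t) = t
    removeAt (a ∷ A) (x ∷ t) = x ∷ removeAt A t

    lookup-slot : ∀ A → List.lookup (A ++ z ∷ B) (slot A) ≡ z
    lookup-slot [] = refl
    lookup-slot (a ∷ A) = lookup-slot A

    lookup-skip : ∀ A q → List.lookup (A ++ z ∷ B) (skip A q) ≡ List.lookup (A ++ B) q
    lookup-skip [] q = refl
    lookup-skip (a ∷ A) zero = refl
    lookup-skip (a ∷ A) (suc q) = lookup-skip A q

    insertAt-slot : ∀ A K t → Vec.lookup (insertAt A K t) (slot A) ≡ K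
    insertAt-slot [] K t = refl
    insertAt-slot (a ∷ A) K (x ∷ t) = insertAt-slot A K t

    insertAt-skip : ∀ A K t q → Vec.lookup (insertAt A K t) (skip A q) ≡ Vec.lookup t q
    insertAt-skip [] K t q = refl
    insertAt-skip (a ∷ A) K (x ∷ t) zero = refl
    insertAt-skip (a ∷ A) K (x ∷ t) (suc q) = insertAt-skip A K t q

    removeAt-lookup : ∀ A t q → Vec.lookup (removeAt A t) q ≡ Vec.lookup t (skip A q)
    removeAt-lookup [] (x ∷ t) q = refl
    removeAt-lookup (a ∷ A) (x ∷ t) zero = refl
    removeAt-lookup (a ∷ A) (x ∷ t) (suc q) = removeAt-lookup A t q

    slot-or-skip : ∀ A p → p ≡ slot A ⊎ Σ[ q ∈ Fin (length (A ++ B)) ] p ≡ skip A q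
    slot-or-skip [] zero = inj₁ refl
    slot-or-skip [] (suc p) = inj₂ (p , refl)
    slot-or-skip (a ∷ A) zero = inj₂ (zero , refl)
    slot-or-skip (a ∷ A) (suc p) with slot-or-skip A p
    ... | inj₁ eq = inj₁ (cong suc eq)
    ... | inj₂ (q , eq) = inj₂ (suc q , cong suc eq)

    skip-injective : ∀ A q q' → skip A q ≡ skip A q' → q ≡ q'
    skip-injective [] q q' eq = Finₚ.suc-injective eq
    skip-injective (a ∷ A) zero zero eq = refl
    skip-injective (a ∷ A) (suc q) (suc q') eq = cong suc (skip-injective A q q' (Finₚ.suc-injective eq))
    skip-injective (a ∷ A) zero (suc q') ()
    skip-injective (a ∷ A) (suc q) zero ()

    skip≢slot : ∀ A q → skip A q ≢ slot A
    skip≢slot [] q ()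
    skip≢slot (a ∷ A) zero ()
    skip≢slot (a ∷ A) (suc q) eq = skip≢slot A q (Finₚ.suc-injective eq)

    removeAt-insertAt : ∀ A K t → removeAt A (insertAt A K t) ≡ t
    removeAt-insertAt [] K t = refl
    removeAt-insertAt (a ∷ A) K (x ∷ t) = cong (x ∷_) (removeAt-insertAt A K t)

    insertAt-removeAt : ∀ A K t → Vec.lookup t (slot A) ≡ K → insertAt A K (removeAt A t) ≡ t
    insertAt-removeAt [] K (x ∷ t) eq = cong (_∷ t) (sym eq)
    insertAt-removeAt (a ∷ A) K (x ∷ t) eq = cong (x ∷_) (insertAt-removeAt A K t eq)

    insertAt-injective : ∀ A K t t' → insertAt A K t ≡ insertAt A K t' → t ≡ t'
    insertAt-injective A K t t' eq = trans (sym (removeAt-insertAt A K t)) (trans (cong (removeAt A) eq) (removeAt-insertAt A K t'))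

  IsCorner : List Square → Square → Set
  IsCorner ys z = ∀ q → proj₁ z ≤ proj₁ (List.lookup ys q) → proj₂ (List.lookup ys q) < proj₂ z

  module _ (A : List Square) (z : Square) (B : List Square) (cc : IsCorner (A ++ B) z) where

    slot-unique : ∀ p → List.lookup (A ++ z ∷ B) p ≡ z → p ≡ slot {z} {B} A
    slot-unique p eq with slot-or-skip {z} {B} A p
    ... | inj₁ e = e
    ... | inj₂ (q , refl) = ⊥-elim (ℕₚ.<-irrefl (cong proj₂ eq') (cc q (ℕₚ.≤-reflexive (cong proj₁ (sym eq')))))
      where eq' = trans (sym (lookup-skip {z} {B} A q)) eq

    insertAt-standard : ∀ K t → IsStandard (A ++ B) K t → IsStandard (A ++ z ∷ B) (suc K) (insertAt {z} {B} A (suc K) t)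
    insertAt-standard K t (rng , inj , rw , cl) = rng' , inj' , rw' , cl'
      where
      P = slot {z} {B} A
      T = insertAt {z} {B} A (suc K) t
      lk : Fin (length (A ++ z ∷ B)) → Square
      lk = List.lookup (A ++ z ∷ B)
      rng' : ∀ p → 1 ≤ Vec.lookup T p × Vec.lookup T p ≤ suc K
      rng' p with slot-or-skip {z} {B} A p
      ... | inj₁ refl rewrite insertAt-slot {z} {B} A (suc K) t = s≤s z≤n , ℕₚ.≤-refl
      ... | inj₂ (q , refl) rewrite insertAt-skip {z} {B} A (suc K) t q = proj₁ (rng q) , ℕₚ.m≤n⇒m≤1+n (proj₂ (rng q))
      small : ∀ q → Vec.lookup T (skip A q) < suc K
      small q rewrite insertAt-skip {z} {B} A (suc K) t q = s≤s (proj₂ (rng q))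
      inj' : ∀ p p' → Vec.lookup T p ≡ Vec.lookup T p' → p ≡ p'
      inj' p p' eq with slot-or-skip {z} {B} A p | slot-or-skip {z} {B} A p'
      ... | inj₁ e | inj₁ e' = trans e (sym e')
      ... | inj₁ refl | inj₂ (q' , refl) = ⊥-elim (ℕₚ.<-irrefl (trans (sym eq) (insertAt-slot {z} {B} A (suc K) t)) (small q'))
      ... | inj₂ (q , refl) | inj₁ refl = ⊥-elim (ℕₚ.<-irrefl (trans eq (insertAt-slot {z} {B} A (suc K) t)) (small q))
      ... | inj₂ (q , refl) | inj₂ (q' , refl) =
         cong (skip A) (inj q q' (trans (sym (insertAt-skip {z} {B} A (suc K) t q)) (trans eq (insertAt-skip {z} {B} A (suc K) t q'))))
      rw' : ∀ p p' → proj₁ (lk p) ≡ proj₁ (lk p') → proj₂ (lk p) < proj₂ (lk p') → Vec.lookup T p < Vec.lookup T p'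
      rw' p p' e1 e2 with slot-or-skip {z} {B} A p | slot-or-skip {z} {B} A p'
      ... | inj₁ refl | inj₁ refl = ⊥-elim (ℕₚ.<-irrefl refl e2)
      ... | inj₁ refl | inj₂ (q' , refl) rewrite lookup-slot {z} {B} A | lookup-skip {z} {B} A q' =
         ⊥-elim (ℕₚ.<-asym (cc q' (ℕₚ.≤-reflexive e1)) e2)
      ... | inj₂ (q , refl) | inj₁ refl rewrite insertAt-slot {z} {B} A (suc K) t = small q
      ... | inj₂ (q , refl) | inj₂ (q' , refl) rewrite insertAt-skip {z} {B} A (suc K) t q | insertAt-skip {z} {B} A (suc K) t q'
         | lookup-skip {z} {B} A q | lookup-skip {z} {B} A q' = rw q q' e1 e2
      cl' : ∀ p p' → proj₂ (lk p) ≡ proj₂ (lk p') → proj₁ (lk p) < proj₁ (lk p') → Vec.lookup T p < Vec.lookup T p'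
      cl' p p' e1 e2 with slot-or-skip {z} {B} A p | slot-or-skip {z} {B} A p'
      ... | inj₁ refl | inj₁ refl = ⊥-elim (ℕₚ.<-irrefl refl e2)
      ... | inj₁ refl | inj₂ (q' , refl) rewrite lookup-slot {z} {B} A | lookup-skip {z} {B} A q' =
         ⊥-elim (ℕₚ.<-irrefl (sym e1) (cc q' (ℕₚ.<⇒≤ e2)))
      ... | inj₂ (q , refl) | inj₁ refl rewrite insertAt-slot {z} {B} A (suc K) t = small q
      ... | inj₂ (q , refl) | inj₂ (q' , refl) rewrite insertAt-skip {z} {B} A (suc K) t q | insertAt-skip {z} {B} A (suc K) t q'
         | lookup-skip {z} {B} A q | lookup-skip {z} {B} A q' = cl q q' e1 e2

    removeAt-standard : ∀ K t → IsStandard (A ++ z ∷ B) (suc K) t → Vec.lookup t (slot {z} {B} A) ≡ suc K → IsStandard (A ++ B) K (removeAt {z} {B} A t)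
    removeAt-standard K t (rng , inj , rw , cl) tp = rng' , inj' , rw' , cl'
      where
      rng' : ∀ q → 1 ≤ Vec.lookup (removeAt A t) q × Vec.lookup (removeAt A t) q ≤ K
      rng' q rewrite removeAt-lookup {z} {B} A t q = proj₁ (rng (skip A q)) , le
        where
        le : Vec.lookup t (skip A q) ≤ K
        le with ℕₚ.m≤n⇒m<n∨m≡n (proj₂ (rng (skip A q)))
        ... | inj₁ (s≤s lt) = lt
        ... | inj₂ eq = ⊥-elim (skip≢slot {z} {B} A q (inj _ _ (trans eq (sym tp))))
      inj' : ∀ q q' → Vec.lookup (removeAt A t) q ≡ Vec.lookup (removeAt A t) q' → q ≡ q'
      inj' q q' eq rewrite removeAt-lookup {z} {B} A t q | removeAt-lookup {z} {B} A t q' = skip-injective {z} {B} A q q' (inj _ _ eq)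
      rw' : ∀ q q' → proj₁ (List.lookup (A ++ B) q) ≡ proj₁ (List.lookup (A ++ B) q') →
        proj₂ (List.lookup (A ++ B) q) < proj₂ (List.lookup (A ++ B) q') → Vec.lookup (removeAt A t) q < Vec.lookup (removeAt A t) q'
      rw' q q' e1 e2 rewrite removeAt-lookup {z} {B} A t q | removeAt-lookup {z} {B} A t q' | sym (lookup-skip {z} {B} A q) | sym (lookup-skip {z} {B} A q') 
        = rw _ _ e1 e2
      cl' : ∀ q q' → proj₂ (List.lookup (A ++ B) q) ≡ proj₂ (List.lookup (A ++ B) q') →
        proj₁ (List.lookup (A ++ B) q) < proj₁ (List.lookup (A ++ B) q') → Vec.lookup (removeAt A t) q < Vec.lookup (removeAt A t) q'
      cl' q q' e1 e2 rewrite removeAt-lookup {z} {B} A t q | removeAt-lookup {z} {B} A t q' | sym (lookup-skip {z} {B} A q) | sym (lookup-skip {z} {B} A q') 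
        = cl _ _ e1 e2

    insertAt-list : ∀ K (L' : List (Vec ℕ (length (A ++ B)))) → Unique L' → (∀ t' → (t' ∈ L') ⇔ IsStandard (A ++ B) K t') →
      Σ[ tableaux ∈ List (Vec ℕ (length (A ++ z ∷ B))) ] (Unique tableaux × length tableaux ≡ length L' ×
        (∀ t → (t ∈ tableaux) ⇔ (IsStandard (A ++ z ∷ B) (suc K) t × Vec.lookup t (slot {z} {B} A) ≡ suc K)))
    insertAt-list K L' u mem = List.map (insertAt A (suc K)) L' ,
      Uniqueₚ.map⁺ (λ {x} {y} → insertAt-injective {z} {B} A (suc K) x y) u , Listₚ.length-map _ L' , λ t → mk⇔ (to t) (from t)
      where
      to : ∀ t → t ∈ List.map (insertAt A (suc K)) L' → IsStandard (A ++ z ∷ B) (suc K) t × Vec.lookup t (slot A) ≡ suc K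
      to t m with ∈-map⁻ (insertAt A (suc K)) m
      ... | t' , m' , refl = insertAt-standard K t' (Equivalence.to (mem t') m') , insertAt-slot {z} {B} A (suc K) t'
      from : ∀ t → IsStandard (A ++ z ∷ B) (suc K) t × Vec.lookup t (slot A) ≡ suc K → t ∈ List.map (insertAt A (suc K)) L'
      from t (s , tp) = subst (_∈ List.map (insertAt A (suc K)) L') (insertAt-removeAt {z} {B} A (suc K) t tp)
        (∈-map⁺ (insertAt A (suc K)) (Equivalence.from (mem (removeAt A t)) (removeAt-standard K t s tp)))

  concatFin : ∀ {X : Set} k → (Fin k → List X) → List X
  concatFin zero f = []
  concatFin (suc k) f = f zero ++ concatFin k (f ∘ suc)

  ι-length-++ : ∀ {X : Set} (xs ys : List X) → ι (length (xs ++ ys)) ≡ ι (length xs) + ι (length ys)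
  ι-length-++ xs ys = trans (cong ι (Listₚ.length-++ xs)) (ι-+ (length xs) (length ys))

  ι-length-concatFin : ∀ {X : Set} k (f : Fin k → List X) → ι (length (concatFin k f)) ≡ ∑[ i < k ] ι (length (f i))
  ι-length-concatFin zero    f = refl
  ι-length-concatFin (suc k) f = trans (ι-length-++ (f zero) (concatFin k (f ∘ suc))) (cong (ι (length (f zero)) +_) (ι-length-concatFin k (f ∘ suc)))

  ∈-concatFin⁻ : ∀ {X : Set} k (f : Fin k → List X) {x} → x ∈ concatFin k f → Σ[ i ∈ Fin k ] x ∈ f i
  ∈-concatFin⁻ (suc k) f m with ∈-++⁻ (f zero) m
  ... | inj₁ m' = zero , m'
  ... | inj₂ m' with ∈-concatFin⁻ k (f ∘ suc) m'
  ...   | i , m'' = suc i , m''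

  ∈-concatFin⁺ : ∀ {X : Set} k (f : Fin k → List X) {x} i → x ∈ f i → x ∈ concatFin k f
  ∈-concatFin⁺ (suc k) f zero m = ∈-++⁺ˡ m
  ∈-concatFin⁺ (suc k) f (suc i) m = ∈-++⁺ʳ (f zero) (∈-concatFin⁺ k (f ∘ suc) i m)

  unique-concatFin : ∀ {X : Set} k (f : Fin k → List X) → (∀ i → Unique (f i)) →
    (∀ i j {x} → x ∈ f i → x ∈ f j → i ≡ j) → Unique (concatFin k f)
  unique-concatFin zero f u dj = []
  unique-concatFin (suc k) f u dj =
    Uniqueₚ.++⁺ (u zero) (unique-concatFin k (f ∘ suc) (u ∘ suc) (λ i j m m' → Finₚ.suc-injective (dj (suc i) (suc j) m m')))
    λ { (m , m') → case (∈-concatFin⁻ k (f ∘ suc) m') m }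
    where
    case : ∀ {x} → Σ[ i ∈ Fin k ] x ∈ f (suc i) → x ∈ f zero → ⊥
    case (i , m') m with dj zero (suc i) m m'
    ... | ()

  largest-entry : ∀ {L} K (t : Vec ℕ L) → L ≡ suc K → (∀ p → 1 ≤ Vec.lookup t p × Vec.lookup t p ≤ suc K) →
    (∀ p q → Vec.lookup t p ≡ Vec.lookup t q → p ≡ q) → Σ[ p ∈ Fin L ] Vec.lookup t p ≡ suc K
  largest-entry K t refl range inj with Finₚ.any? (λ p → Vec.lookup t p ℕ.≟ suc K)
  ... | yes found = found
  ... | no  none  = ⊥-elim (ℕₚ.<-irrefl (cong toℕ (inj i j same-entry)) i<j)
    where
    below : ∀ p → ℕ.pred (Vec.lookup t p) < K
    below p with Vec.lookup t p in tₚ≡ | range p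
    ... | suc x | _ , x<1+K with ℕₚ.m≤n⇒m<n∨m≡n x<1+K
    ...   | inj₁ (s≤s x<K) = x<K
    ...   | inj₂ x≡1+K     = ⊥-elim (none (p , trans tₚ≡ x≡1+K))
    collision = Finₚ.pigeonhole (ℕₚ.n<1+n K) (λ p → Fin.fromℕ< (below p))
    i = proj₁ collision
    j = proj₁ (proj₂ collision)
    i<j = proj₁ (proj₂ (proj₂ collision))
    suc-pred : ∀ p → suc (ℕ.pred (Vec.lookup t p)) ≡ Vec.lookup t p
    suc-pred p = ℕₚ.suc-pred (Vec.lookup t p) {{ℕ.>-nonZero (proj₁ (range p))}}
    same-entry : Vec.lookup t i ≡ Vec.lookup t j
    same-entry = trans (sym (suc-pred i)) (trans (cong suc (trans (sym (Finₚ.toℕ-fromℕ< (below i)))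
      (trans (cong toℕ (proj₂ (proj₂ (proj₂ collision)))) (Finₚ.toℕ-fromℕ< (below j))))) (suc-pred j))

  corner-list : ∀ (xs xs' A B : List Square) (z : Square) → xs ≡ A ++ z ∷ B → xs' ≡ A ++ B → IsCorner (A ++ B) z →
    ∀ K (L' : List (Vec ℕ (length xs'))) → Unique L' → (∀ t' → (t' ∈ L') ⇔ IsStandard xs' K t') →
    Σ[ P0 ∈ Fin (length xs) ] (List.lookup xs P0 ≡ z × (∀ P → List.lookup xs P ≡ z → P ≡ P0) ×
      Σ[ tableaux ∈ List (Vec ℕ (length xs)) ] (Unique tableaux × length tableaux ≡ length L' ×
        (∀ t → (t ∈ tableaux) ⇔ (IsStandard xs (suc K) t × Vec.lookup t P0 ≡ suc K))))
  corner-list .(A ++ z ∷ B) .(A ++ B) A B z refl refl cc K L' u mem =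
    slot {z} {B} A , lookup-slot {z} {B} A , slot-unique A z B cc , insertAt-list A z B cc K L' u mem

  -- Empty unless `Cond`, which tells the lists for different squares apart.
  record LargestAt {n} (v : Vec ℕ n) (z : Square) (Cond : Set) (val : ℚ) : Set where
    field
      list : List (Filling v)
      unique : Unique list
      sound : ∀ {t} → t ∈ list → Cond × IsSYT v t × Σ[ P ∈ Cell v ] (List.lookup (cells v) P ≡ z × Vec.lookup t P ≡ size v)
      complete : Cond → ∀ t → IsSYT v t → ∀ P → List.lookup (cells v) P ≡ z → Vec.lookup t P ≡ size v → t ∈ list
      value : ι (length list) ≡ val

  largestAt-empty : ∀ {n} (v : Vec ℕ n) z (Cond : Set) val → ¬ Cond → val ≡ 0ℚ → LargestAt v z Cond val
  largestAt-empty v z Cond val nc eq = record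
    { list = [] ; unique = [] ; sound = λ () ; complete = λ c → ⊥-elim (nc c)
    ; value = sym eq }

  largestAt-corner : ∀ {n n2} (v : Vec ℕ n) (v' : Vec ℕ n2) (A B : List Square) z (Cond : Set) val K →
    cells v ≡ A ++ z ∷ B → cells v' ≡ A ++ B → IsCorner (A ++ B) z → size v ≡ suc K → size v' ≡ K →
    NumSYTEquals v' (rhs v') → Cond → rhs v' ≡ val → LargestAt v z Cond val
  largestAt-corner v v' A B z Cond val K e1 e2 cc size≡ sz' (L' , u' , mem' , val') c veq with
    corner-list (cells v) (cells v') A B z e1 e2 cc K L' u'
      (λ t' → subst (λ k → (t' ∈ L') ⇔ IsStandard (cells v') k t') sz' (mem' t'))
  ... | P0 , lk0 , uniq0 , tableaux , u , len , mem = record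
    { list = tableaux ; unique = u
    ; sound = λ {t} m → c , subst (λ k → IsStandard (cells v) k t) (sym size≡) (proj₁ (Equivalence.to (mem t) m)) ,
         P0 , lk0 , trans (proj₂ (Equivalence.to (mem t) m)) (sym size≡)
    ; complete = λ _ t syt P lkP tP → Equivalence.from (mem t)
         (subst (λ k → IsStandard (cells v) k t) size≡ syt , subst (λ p → Vec.lookup t p ≡ suc K) (uniq0 P lkP) (trans tP size≡))
    ; value = trans (cong ι len) (trans val' veq) }

  rowEnd : ∀ {n} (v : Vec ℕ n) → Fin n → Square
  rowEnd v i = (toℕ i , toℕ i ℕ.+ ℕ.pred (Vec.lookup v i))

  module InductionStep {n' : ℕ} (v : Vec ℕ (suc n')) (strict : Strict v) (K : ℕ) (size≡ : size v ≡ suc K)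
    (IH : ∀ {m} (w : Vec ℕ m) → Strict w → size w ≡ K → NumSYTEquals w (rhs w)) where
    open CornerTerms v strict K size≡

    part-corner : ∀ i → Strict (shrinkRow i v) → ∀ l → Vec.lookup v i ≡ suc l →
      Σ[ A ∈ List Square ] Σ[ B ∈ List Square ] (cells v ≡ A ++ (toℕ i , toℕ i ℕ.+ l) ∷ B × cells (shrinkRow i v) ≡ A ++ B) →
      LargestAt v (rowEnd v i) (Strict (shrinkRow i v)) (term i)
    part-corner i d' l eqi (A , B , e1 , e2) =
      largestAt-corner v (shrinkRow i v) A B (rowEnd v i) (Strict (shrinkRow i v)) (term i) K (trans e1 (cong (λ z → A ++ z ∷ B) zeq)) e2 cc' size≡ szd
        (IH (shrinkRow i v) d' szd) d' (term-corner i d')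
      where
      zeq : (toℕ i , toℕ i ℕ.+ l) ≡ rowEnd v i
      zeq = cong (λ x → (toℕ i , toℕ i ℕ.+ ℕ.pred x)) (sym eqi)
      szd : size (shrinkRow i v) ≡ K
      szd = ℕₚ.suc-injective (trans (size-shrinkRow v i l eqi) size≡)
      cc : IsCorner (A ++ B) (toℕ i , toℕ i ℕ.+ l)
      cc q h = shrinkRow-below 0 v i l eqi d' (List.lookup (A ++ B) q) (subst (List.lookup (A ++ B) q ∈_) (sym e2) (∈-lookup q)) h
      cc' : IsCorner (A ++ B) (rowEnd v i)
      cc' = subst (IsCorner (A ++ B)) zeq cc

    part : ∀ i → LargestAt v (rowEnd v i) (Strict (shrinkRow i v)) (term i)
    part i with strict? (shrinkRow i v)
    ... | no ¬strict′ = largestAt-empty v (rowEnd v i) _ (term i) ¬strict′ (term-noncorner i ¬strict′)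
    ... | yes strict′ = part-corner′ (Vec.lookup v i) refl
      where
      part-corner′ : ∀ x → Vec.lookup v i ≡ x → LargestAt v (rowEnd v i) (Strict (shrinkRow i v)) (term i)
      part-corner′ zero    vᵢ≡ = ⊥-elim (ℕₚ.<-irrefl (sym vᵢ≡) (Strict⇒positive v strict i))
      part-corner′ (suc l) vᵢ≡ = part-corner i strict′ l vᵢ≡ (cellsFrom-shrinkRow 0 v i l vᵢ≡)

    lastCell : Square
    lastCell = (n' , n' ℕ.+ 0)

    partLast : LargestAt v lastCell (Vec.lookup v (Fin.fromℕ n') ≡ 1) boundaryTerm
    partLast with Vec.lookup v (Fin.fromℕ n') ℕ.≟ 1
    ... | no last≢1  = largestAt-empty v lastCell _ boundaryTerm last≢1 (boundaryTerm-vanishes last≢1)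
    ... | yes last≡1 = largestAt-corner v (dropLast v) (cells (dropLast v)) [] lastCell _ boundaryTerm K
      (cellsFrom-dropLast 0 v last≡1) (sym (Listₚ.++-identityʳ _)) corner size≡ size′
      (IH (dropLast v) (Strict-dropLast v strict) size′) last≡1 (boundaryTerm-last last≡1)
      where
      size′ : size (dropLast v) ≡ K
      size′ = ℕₚ.suc-injective (trans (size-dropLast v last≡1) size≡)
      corner : IsCorner (cells (dropLast v) ++ []) lastCell
      corner q h = ⊥-elim (ℕₚ.<-irrefl refl (ℕₚ.<-≤-trans (row< 0 (dropLast v) _
        (subst (List.lookup (cells (dropLast v) ++ []) q ∈_) (Listₚ.++-identityʳ _) (∈-lookup q))) h))

    lists : Fin (suc n') → List (Filling v)
    lists i = LargestAt.list (part i)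

    tableaux : List (Filling v)
    tableaux = concatFin (suc n') lists ++ LargestAt.list partLast

    largest-unique : ∀ t → IsSYT v t → ∀ P P' → Vec.lookup t P ≡ size v → Vec.lookup t P' ≡ size v → P ≡ P'
    largest-unique t syt P P' e e' = proj₁ (proj₂ syt) P P' (trans e (sym e'))

    tableaux-unique : Unique tableaux
    tableaux-unique = Uniqueₚ.++⁺ (unique-concatFin (suc n') lists (λ i → LargestAt.unique (part i)) dj) (LargestAt.unique partLast) djB
      where
      dj : ∀ i j {t} → t ∈ lists i → t ∈ lists j → i ≡ j
      dj i j {t} m m' with LargestAt.sound (part i) m | LargestAt.sound (part j) m'
      ... | _ , syt , P , lk , tp | _ , _ , P' , lk' , tp' =
        Finₚ.toℕ-injective (cong proj₁ (trans (sym lk) (trans (cong (List.lookup (cells v)) (largest-unique t syt P P' tp tp')) lk')))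
      djB : ∀ {t} → (t ∈ concatFin (suc n') lists × t ∈ LargestAt.list partLast) → ⊥
      djB {t} (m , m') with ∈-concatFin⁻ (suc n') lists m
      ... | i , mi with LargestAt.sound (part i) mi | LargestAt.sound partLast m'
      ...   | d' , syt , P , lk , tp | _ , _ , P' , lk' , tp' = contra
        where
        zeq : rowEnd v i ≡ lastCell
        zeq = trans (sym lk) (trans (cong (List.lookup (cells v)) (largest-unique t syt P P' tp tp')) lk')
        p0 : ℕ.pred (Vec.lookup v i) ≡ 0
        p0 = ℕₚ.+-cancelˡ-≡ (toℕ i) _ _ (trans (cong proj₂ zeq) (cong (ℕ._+ 0) (sym (cong proj₁ zeq))))
        helper : ∀ x → Vec.lookup v i ≡ x → ℕ.pred x ≡ 0 → ⊥
        helper zero eqi _ = ℕₚ.<-irrefl (sym eqi) (Strict⇒positive v strict i)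
        helper (suc l) eqi pz with corner-length v i l eqi d'
        ... | l' , refl with pz
        ... | ()
        contra : ⊥
        contra = helper (Vec.lookup v i) refl p0

    tableaux-complete : ∀ t → (t ∈ tableaux) ⇔ IsSYT v t
    tableaux-complete t = mk⇔ to from
      where
      to : t ∈ tableaux → IsSYT v t
      to m with ∈-++⁻ (concatFin (suc n') lists) m
      ... | inj₂ m' = proj₁ (proj₂ (LargestAt.sound partLast m'))
      ... | inj₁ m' with ∈-concatFin⁻ (suc n') lists m'
      ...   | i , mi = proj₁ (proj₂ (LargestAt.sound (part i) mi))
      from : IsSYT v t → t ∈ tableaux
      from syt = fromP syt (largest-entry K t (trans (length-cellsFrom 0 v) size≡)
           (λ p → proj₁ (proj₁ syt p) , subst (Vec.lookup t p ≤_) size≡ (proj₂ (proj₁ syt p))) (proj₁ (proj₂ syt)))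
        where
        fromP : IsSYT v t → Σ[ P ∈ Fin (length (cells v)) ] Vec.lookup t P ≡ suc K → t ∈ tableaux
        fromP syt@(rng , inj , rw , cl) (P , tP) = result (corner-classification v strict w mw nr nd)
          where
          w = List.lookup (cells v) P
          mw : w ∈ cells v
          mw = ∈-lookup P
          tP' : Vec.lookup t P ≡ size v
          tP' = trans tP (sym size≡)
          nr : ¬ ((proj₁ w , suc (proj₂ w)) ∈ cells v)
          nr m' = ℕₚ.<-irrefl refl (ℕₚ.<-≤-trans (subst (_< Vec.lookup t q) tP' lt) (proj₂ (rng q)))
            where
            q = Any.index m'
            eqq : (proj₁ w , suc (proj₂ w)) ≡ List.lookup (cells v) q
            eqq = Anyₚ.lookup-index m'
            lt : Vec.lookup t P < Vec.lookup t q
            lt = rw P q (cong proj₁ eqq) (subst (proj₂ w <_) (cong proj₂ eqq) (ℕₚ.n<1+n (proj₂ w)))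
          nd : ¬ ((suc (proj₁ w) , proj₂ w) ∈ cells v)
          nd m' = ℕₚ.<-irrefl refl (ℕₚ.<-≤-trans (subst (_< Vec.lookup t q) tP' lt) (proj₂ (rng q)))
            where
            q = Any.index m'
            eqq : (suc (proj₁ w) , proj₂ w) ≡ List.lookup (cells v) q
            eqq = Anyₚ.lookup-index m'
            lt : Vec.lookup t P < Vec.lookup t q
            lt = cl P q (cong proj₂ eqq) (subst (proj₁ w <_) (cong proj₁ eqq) (ℕₚ.n<1+n (proj₁ w)))
          result : (Σ[ i ∈ Fin (suc n') ] Σ[ l ∈ ℕ ] (Vec.lookup v i ≡ suc l × w ≡ (toℕ i , toℕ i ℕ.+ l) ×
                     (Strict (shrinkRow i v) ⊎ (l ≡ 0 × suc (toℕ i) ≡ suc n')))) → t ∈ tableaux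
          result (i , l , eqi , weq , inj₁ d') = ∈-++⁺ˡ (∈-concatFin⁺ (suc n') lists i
                (LargestAt.complete (part i) d' t syt P (trans weq (cong (λ x → (toℕ i , toℕ i ℕ.+ ℕ.pred x)) (sym eqi))) tP'))
          result (i , l , eqi , weq , inj₂ (l0 , si)) = ∈-++⁺ʳ (concatFin (suc n') lists)
                (LargestAt.complete partLast eql t syt P (trans weq (cong₂ (λ x y → (x , x ℕ.+ y)) ti l0)) tP')
            where
            ti : toℕ i ≡ n'
            ti = ℕₚ.suc-injective si
            ieq : i ≡ Fin.fromℕ n'
            ieq = Finₚ.toℕ-injective (trans ti (sym (Finₚ.toℕ-fromℕ n')))
            eql : Vec.lookup v (Fin.fromℕ n') ≡ 1
            eql = subst (λ j → Vec.lookup v j ≡ 1) ieq (trans eqi (cong suc l0))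

    result : NumSYTEquals v (rhs v)
    result = tableaux , tableaux-unique , tableaux-complete , (begin
      ι (length tableaux)
        ≡⟨ ι-length-++ (concatFin (suc n') lists) (LargestAt.list partLast) ⟩
      ι (length (concatFin (suc n') lists)) + ι (length (LargestAt.list partLast))
        ≡⟨ cong₂ _+_ (ι-length-concatFin (suc n') lists) (LargestAt.value partLast) ⟩
      ∑[ i < suc n' ] ι (length (lists i)) + boundaryTerm
        ≡⟨ cong (_+ boundaryTerm) (sum-cong-≗ (LargestAt.value ∘ part)) ⟩
      ∑[ i < suc n' ] term i + boundaryTerm
        ≡⟨ sym rhs-recursion ⟩
      rhs v ∎)
      where open ≡-Reasoning



open ShiftedShapes
open TableauRecursion

numSYT-empty : NumSYTEquals [] (rhs [])
numSYT-empty = [] ∷ [] , All.[] AllPairs.∷ AllPairs.[] , (λ t → mk⇔ (λ _ → (λ ()) , (λ ()) , (λ ()) , (λ ())) (from t)) , refl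
  where
  from : ∀ t → IsSYT [] t → t ∈ [] ∷ []
  from [] _ = here refl

numSYT-by-size : ∀ K {n} (v : Vec ℕ n) → Strict v → size v ≡ K → NumSYTEquals v (rhs v)
numSYT-by-size zero    []      strict size≡ = numSYT-empty
numSYT-by-size zero    (x ∷ v) strict size≡ =
  ⊥-elim (ℕₚ.<-irrefl (sym size≡) (ℕₚ.<-≤-trans (Strict⇒positive (x ∷ v) strict zero) (ℕₚ.m≤m+n x (size v))))
numSYT-by-size (suc K) (x ∷ v) strict size≡ = InductionStep.result (x ∷ v) strict K size≡ (λ w → numSYT-by-size K w)

proposition2p4 : (n : ℕ) (lam : Vec ℕ n) → StrictPartition lam →
    NumSYTEquals lam (rhs lam)
proposition2p4 n lam sp = numSYT-by-size (size lam) lam (StrictPartition⇒Strict lam sp) refl
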